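{- Let $C>0$. There exists $c>0$ depending only on $C$ such that the following holds for all $n$ sufficiently large depending on $C$: if $v_1,\dots,v_n$ are positive integers with $v_i \leq Cn$ for all $i=1,\dots,n$, then $\delta(v_1,\dots,v_n) \geq \frac{1+c}{2n}$.
   Context: For $t \in \mathbb{R}/\mathbb{Z}$, $\|t\|_{\mathbb{R}/\mathbb{Z}}$ denotes the distance from (any representative of) $t$ to the nearest integer. For non-zero integers $v_1,\dots,v_n$, $\delta(v_1,\dots,v_n)$ denotes the maximum over $t \in \mathbb{R}/\mathbb{Z}$ of $\min(\|tv_1\|_{\mathbb{R}/\mathbb{Z}},\dots,\|tv_n\|_{\mathbb{R}/\mathbb{Z}})$.
   Formalization: The constant C ranges over the positive rationals, and the constant c and the point t witnessing the lower bound on δ are taken in ℚ. -}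

module Defs where

open import Data.Nat using (ℕ; suc)
open import Data.Integer using (ℤ)
open import Data.Fin using (Fin)
open import Data.Product using (∃)
open import Data.Rational using (ℚ; _+_; _-_; _*_; _≤_; _⊓_; floor; ceiling; _/_)

ℤ→ℚ : ℤ → ℚ
ℤ→ℚ z = z / 1

‖_‖ : ℚ → ℚ
‖ x ‖ = (x - ℤ→ℚ (floor x)) ⊓ (ℤ→ℚ (ceiling x) - x)

-- δ(v₁,…,vₙ) ≥ a  :  some t has min_i ‖ t vᵢ ‖ ≥ a.
-- (The max over t ∈ ℝ/ℤ is attained; for rational a the feasible set
--  {t : ∀ i, ‖ t vᵢ ‖ ≥ a} is a finite union of closed intervals with
--  rational endpoints, so it is nonempty iff it contains a rational t.)
δ-≥ : ∀ {n} → (Fin n → ℤ) → ℚ → Set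
δ-≥ {n} v a = ∃ λ (t : ℚ) → ∀ (i : Fin n) → a ≤ ‖ t * ℤ→ℚ (v i) ‖

module Submission where

-- Write t = k / L with L a multiple of every vᵢ, so that ‖t vᵢ‖ ≥ X / Y becomes
-- X L ≤ Y · (distance from k vᵢ to L ℤ), and count the k < L that are bad for some i.
-- Each bad set has at most about 2 X L / Y = L (1 + 1/d) / n elements, so the union
-- bound alone only yields 1 / (2n); the gain comes from overlaps.  Let P = (2^j)! with
-- j = 16 C.  Dividing vᵢ E = 8 C times by its gcd with P gives vᵢ = sᵢ wᵢ with sᵢ ≤ S = P^E,
-- where wᵢ is coprime to P or wᵢ ≤ vᵢ / 2^E.  Integers coprime to P have density at most
-- 2 / j (a harmonic-sum argument) and only C n / 2^E values are that small, so at most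
-- n / 2 distinct values wᵢ occur.  The bad set of vᵢ contains the core
-- {k : Y S · dist(k wᵢ, L ℤ) < X L}, which depends only on wᵢ, so the n / 2 indices whose
-- wᵢ already occurred are counted twice on sets of about X L / (Y S) elements.  With
-- X / Y = (1 + 1/d) / (2n) and d = 4 S, this saving exceeds the excess L / d of ∑ |Badᵢ|
-- over L, so some k < L is bad for no i.

module Discrete where

  open import Level using (Level)
  open import Data.Nat
  open import Data.Nat.Properties
  open import Data.Nat.Divisibility
  open import Data.Nat.DivMod
  open import Data.Nat.GCD using (gcd; gcd[m,n]∣m; gcd[m,n]≤n; gcd[m,n]≢0)
  open import Data.Nat.Coprimality using (Coprime; coprime?; gcd≡1⇒coprime; coprime-divisor; coprime-+)
  open import Data.Fin using (Fin; zero; suc; toℕ)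
  open import Data.Fin.Properties using (any?; toℕ-injective)
  import Data.Fin.Properties as Finₚ
  open import Data.Product using (∃; _×_; _,_; proj₁; proj₂)
  open import Data.Sum using (_⊎_; inj₁; inj₂; map₂)
  open import Data.Empty using (⊥-elim)
  open import Function using (_∘_; case_of_)
  open import Relation.Nullary using (Dec; yes; no; ¬_)
  open import Relation.Nullary.Decidable using (¬?; _×-dec_; _⊎-dec_)
  open import Relation.Binary.Definitions using (tri<; tri≈; tri>)
  open import Relation.Binary.PropositionalEquality
  open import Data.Nat.Tactic.RingSolver using (solve-∀)
  open import Algebra.Properties.CommutativeSemigroup +-commutativeSemigroup
    using () renaming (interchange to +-interchange)
  open import Algebra.Properties.CommutativeSemigroup *-commutativeSemigroup
    using () renaming (x∙yz≈y∙xz to *-left-comm)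
  open import Algebra.Properties.CommutativeMonoid.Sum +-0-commutativeMonoid
    using (sum; sum-cong-≗; ∑-distrib-+)
  open import Algebra.Properties.Semiring.Sum +-*-semiring using (*-distribˡ-sum)

  private
    variable
      a b : Level
      A : Set a
      B : Set b

  χ : Dec A → ℕ
  χ (yes _) = 1
  χ (no _)  = 0

  χ-yes : (A? : Dec A) → A → χ A? ≡ 1
  χ-yes (yes _) _  = refl
  χ-yes (no ¬a) a  = ⊥-elim (¬a a)

  χ-no : (A? : Dec A) → ¬ A → χ A? ≡ 0
  χ-no (yes a) ¬a = ⊥-elim (¬a a)
  χ-no (no _)  _  = refl

  χ-mono : (A? : Dec A) (B? : Dec B) → (A → B) → χ A? ≤ χ B?
  χ-mono (yes a) B?      A⇒B = ≤-reflexive (sym (χ-yes B? (A⇒B a)))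
  χ-mono (no _)  _       _   = z≤n

  χ-cong : (A? : Dec A) (B? : Dec B) → (A → B) → (B → A) → χ A? ≡ χ B?
  χ-cong A? B? A⇒B B⇒A = ≤-antisym (χ-mono A? B? A⇒B) (χ-mono B? A? B⇒A)

  χ-× : (A? : Dec A) (B? : Dec B) → χ (A? ×-dec B?) ≡ χ A? * χ B?
  χ-× (yes _) (yes _) = refl
  χ-× (yes _) (no _)  = refl
  χ-× (no _)  _       = refl

  χ-⊎ : (A? : Dec A) (B? : Dec B) → χ (A? ⊎-dec B?) ≤ χ A? + χ B?
  χ-⊎ (yes _) _       = s≤s z≤n
  χ-⊎ (no _)  (yes _) = s≤s z≤n
  χ-⊎ (no _)  (no _)  = z≤n

  χ-¬ : (A? : Dec A) → χ A? + χ (¬? A?) ≡ 1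
  χ-¬ (yes _) = refl
  χ-¬ (no _)  = refl

  χ-split : (A? : Dec A) (B? : Dec B) → (B → A) → χ A? ≡ χ B? + χ (A? ×-dec ¬? B?)
  χ-split (yes _) (yes _) _   = refl
  χ-split (yes _) (no _)  _   = refl
  χ-split (no ¬a) (yes b) B⇒A = ⊥-elim (¬a (B⇒A b))
  χ-split (no _)  (no _)  _   = refl

  infix 2 sumℕ
  sumℕ : ℕ → (ℕ → ℕ) → ℕ
  sumℕ zero    f = 0
  sumℕ (suc n) f = sumℕ n f + f n
  syntax sumℕ n (λ k → e) = ∑ℕ[ k < n ] e

  sumℕ-cong : ∀ n {f g : ℕ → ℕ} → (∀ k → k < n → f k ≡ g k) → sumℕ n f ≡ sumℕ n g
  sumℕ-cong zero    _   = refl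
  sumℕ-cong (suc n) f≡g = cong₂ _+_ (sumℕ-cong n (λ k k<n → f≡g k (m<n⇒m<1+n k<n))) (f≡g n ≤-refl)

  sumℕ-mono-≤ : ∀ n {f g : ℕ → ℕ} → (∀ k → k < n → f k ≤ g k) → sumℕ n f ≤ sumℕ n g
  sumℕ-mono-≤ zero    _   = z≤n
  sumℕ-mono-≤ (suc n) f≤g = +-mono-≤ (sumℕ-mono-≤ n (λ k k<n → f≤g k (m<n⇒m<1+n k<n))) (f≤g n ≤-refl)

  sumℕ-distrib-+ : ∀ n (f g : ℕ → ℕ) → (∑ℕ[ k < n ] (f k + g k)) ≡ sumℕ n f + sumℕ n g
  sumℕ-distrib-+ zero    f g = refl
  sumℕ-distrib-+ (suc n) f g rewrite sumℕ-distrib-+ n f g =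
    +-interchange (sumℕ n f) (sumℕ n g) (f n) (g n)

  *-distribˡ-sumℕ : ∀ n c (f : ℕ → ℕ) → c * sumℕ n f ≡ (∑ℕ[ k < n ] c * f k)
  *-distribˡ-sumℕ zero    c f = *-zeroʳ c
  *-distribˡ-sumℕ (suc n) c f rewrite sym (*-distribˡ-sumℕ n c f) = *-distribˡ-+ c (sumℕ n f) (f n)

  sumℕ-const : ∀ n c → (∑ℕ[ _ < n ] c) ≡ n * c
  sumℕ-const zero    c = refl
  sumℕ-const (suc n) c rewrite sumℕ-const n c = +-comm (n * c) c

  sumℕ-++ : ∀ m n (f : ℕ → ℕ) → sumℕ (m + n) f ≡ sumℕ m f + (∑ℕ[ k < n ] f (m + k))
  sumℕ-++ m zero    f rewrite +-identityʳ m = sym (+-identityʳ (sumℕ m f))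
  sumℕ-++ m (suc n) f rewrite +-suc m n | sumℕ-++ m n f = +-assoc (sumℕ m f) _ _

  sumℕ-suc : ∀ n (f : ℕ → ℕ) → sumℕ (suc n) f ≡ f 0 + (∑ℕ[ k < n ] f (suc k))
  sumℕ-suc n f = sumℕ-++ 1 n f

  sumℕ-periodic : ∀ q p (f : ℕ → ℕ) → (∀ k → f (p + k) ≡ f k) → sumℕ (q * p) f ≡ q * sumℕ p f
  sumℕ-periodic zero    p f _   = refl
  sumℕ-periodic (suc q) p f per = begin
    sumℕ (p + q * p) f                          ≡⟨ sumℕ-++ p (q * p) f ⟩
    sumℕ p f + (∑ℕ[ k < q * p ] f (p + k))       ≡⟨ cong (sumℕ p f +_) (sumℕ-cong (q * p) (λ k _ → per k)) ⟩
    sumℕ p f + sumℕ (q * p) f                   ≡⟨ cong (sumℕ p f +_) (sumℕ-periodic q p f per) ⟩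
    sumℕ p f + q * sumℕ p f                     ∎
    where open ≡-Reasoning

  sumℕ-comm : ∀ m n (f : ℕ → ℕ → ℕ) → (∑ℕ[ x < m ] ∑ℕ[ a < n ] f a x) ≡ (∑ℕ[ a < n ] ∑ℕ[ x < m ] f a x)
  sumℕ-comm zero    n f = sym (trans (sumℕ-const n 0) (*-zeroʳ n))
  sumℕ-comm (suc m) n f rewrite sumℕ-comm m n f = sym (sumℕ-distrib-+ n (λ a → sumℕ m (f a)) (λ a → f a m))

  sumℕ-reverse : ∀ n (f : ℕ → ℕ) → (∑ℕ[ k < n ] f (n ∸ suc k)) ≡ sumℕ n f
  sumℕ-reverse zero    f = refl
  sumℕ-reverse (suc n) f = begin
    (∑ℕ[ k < suc n ] f (n ∸ k))           ≡⟨ sumℕ-suc n (λ k → f (n ∸ k)) ⟩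
    f n + (∑ℕ[ k < n ] f (n ∸ suc k))     ≡⟨ cong (f n +_) (sumℕ-reverse n f) ⟩
    f n + sumℕ n f                        ≡⟨ +-comm (f n) _ ⟩
    sumℕ (suc n) f                        ∎
    where open ≡-Reasoning

  count-all : ∀ n {P : ℕ → Set a} (P? : ∀ k → Dec (P k)) → (∀ k → k < n → P k) → (∑ℕ[ k < n ] χ (P? k)) ≡ n
  count-all n P? all = trans (sumℕ-cong n (λ k k<n → χ-yes (P? k) (all k k<n))) (trans (sumℕ-const n 1) (*-identityʳ n))

  count-none : ∀ n {P : ℕ → Set a} (P? : ∀ k → Dec (P k)) → (∀ k → k < n → ¬ P k) → (∑ℕ[ k < n ] χ (P? k)) ≡ 0
  count-none n P? none = trans (sumℕ-cong n (λ k k<n → χ-no (P? k) (none k k<n))) (trans (sumℕ-const n 0) (*-zeroʳ n))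

  count<⇒∃¬ : ∀ n {P : ℕ → Set a} (P? : ∀ k → Dec (P k)) → (∑ℕ[ k < n ] χ (P? k)) < n → ∃ λ k → k < n × ¬ P k
  count<⇒∃¬ zero    P? ()
  count<⇒∃¬ (suc n) P? count< with P? n
  ... | no ¬p = n , ≤-refl , ¬p
  ... | yes _ with count<⇒∃¬ n P? (≤-pred (subst (_≤ suc n) (+-comm _ 1) count<))
  ...   | k , k<n , ¬p = k , m<n⇒m<1+n k<n , ¬p

  count-≤1 : ∀ n {P : ℕ → Set a} (P? : ∀ k → Dec (P k)) →
             (∀ k l → k < n → l < n → P k → P l → k ≡ l) → (∑ℕ[ k < n ] χ (P? k)) ≤ 1
  count-≤1 zero    P? unique = z≤n
  count-≤1 (suc n) P? unique with P? n
  ... | no _  = subst (_≤ 1) (sym (+-identityʳ _))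
                  (count-≤1 n P? (λ k l k<n l<n → unique k l (m<n⇒m<1+n k<n) (m<n⇒m<1+n l<n)))
  ... | yes p = ≤-reflexive (cong (_+ 1) (count-none n P? (λ k k<n q → <-irrefl (unique k n (m<n⇒m<1+n k<n) ≤-refl q p) k<n)))

  count-≡ : ∀ n m → m < n → (∑ℕ[ k < n ] χ (k ≟ m)) ≡ 1
  count-≡ (suc n) m m<1+n with m≤n⇒m<n∨m≡n (≤-pred m<1+n)
  ... | inj₁ m<n  = trans (cong (_+ χ (n ≟ m)) (count-≡ n m m<n)) (cong (1 +_) (χ-no (n ≟ m) (λ n≡m → <-irrefl (sym n≡m) m<n)))
  ... | inj₂ refl = trans (cong (_+ χ (m ≟ m)) (count-none m (_≟ m) (λ k k<m k≡m → <-irrefl k≡m k<m))) (χ-yes (m ≟ m) refl)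

  sum-mono-≤ : ∀ {n} {f g : Fin n → ℕ} → (∀ i → f i ≤ g i) → sum f ≤ sum g
  sum-mono-≤ {zero}  _   = z≤n
  sum-mono-≤ {suc n} f≤g = +-mono-≤ (f≤g zero) (sum-mono-≤ (f≤g ∘ suc))

  sum-const : ∀ n c → sum {n} (λ _ → c) ≡ n * c
  sum-const zero    c = refl
  sum-const (suc n) c = cong (c +_) (sum-const n c)

  ≤-sum : ∀ {n} (f : Fin n → ℕ) i → f i ≤ sum f
  ≤-sum f zero    = m≤m+n _ _
  ≤-sum f (suc i) = ≤-trans (≤-sum (f ∘ suc) i) (m≤n+m _ _)

  sum-sumℕ-comm : ∀ {n} L (f : Fin n → ℕ → ℕ) → (∑ℕ[ k < L ] sum (λ i → f i k)) ≡ sum (λ i → sumℕ L (f i))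
  sum-sumℕ-comm {n} zero    f = sym (trans (sum-const n 0) (*-zeroʳ n))
  sum-sumℕ-comm     (suc L) f rewrite sum-sumℕ-comm L f = sym (∑-distrib-+ (λ i → sumℕ L (f i)) (λ i → f i L))

  count-compl : ∀ {n} {P : Fin n → Set a} (P? : ∀ i → Dec (P i)) → sum (λ i → χ (P? i)) + sum (λ i → χ (¬? (P? i))) ≡ n
  count-compl {n = n} P? = begin
    sum (λ i → χ (P? i)) + sum (λ i → χ (¬? (P? i))) ≡⟨ ∑-distrib-+ (λ i → χ (P? i)) (λ i → χ (¬? (P? i))) ⟨
    sum (λ i → χ (P? i) + χ (¬? (P? i)))              ≡⟨ sum-cong-≗ (λ i → χ-¬ (P? i)) ⟩
    sum {n} (λ _ → 1)                                 ≡⟨ trans (sum-const n 1) (*-identityʳ n) ⟩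
    n                                                 ∎
    where open ≡-Reasoning

  count-*≤ : ∀ y z n → y * (∑ℕ[ x < n ] χ (y * x ≤? z)) ≤ z + y
  count-*≤ y z zero    = subst (_≤ z + y) (sym (*-zeroʳ y)) z≤n
  count-*≤ y z (suc n) with y * n ≤? z
  ... | no _   = subst (_≤ z + y) (cong (y *_) (sym (+-identityʳ _))) (count-*≤ y z n)
  ... | yes yn≤z = begin
    y * ((∑ℕ[ x < n ] χ (y * x ≤? z)) + 1) ≡⟨ cong (λ c → y * (c + 1)) (count-all n (λ x → y * x ≤? z) (λ x x<n → ≤-trans (*-monoʳ-≤ y (<⇒≤ x<n)) yn≤z)) ⟩
    y * (n + 1)                             ≡⟨ trans (*-distribˡ-+ y n 1) (cong (y * n +_) (*-identityʳ y)) ⟩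
    y * n + y                               ≤⟨ +-monoˡ-≤ y yn≤z ⟩
    z + y                                   ∎
    where open ≤-Reasoning

  count-*< : ∀ y z n → y * (∑ℕ[ x < n ] χ (y * x <? z)) ≤ z + y
  count-*< y z n = ≤-trans (*-monoʳ-≤ y (sumℕ-mono-≤ n (λ x _ → χ-mono (y * x <? z) (y * x ≤? z) <⇒≤))) (count-*≤ y z n)

  count-∸*< : ∀ y z n → y * (∑ℕ[ k < n ] χ (y * (n ∸ k) <? z)) ≤ z + y
  count-∸*< y z n = begin
    y * (∑ℕ[ k < n ] χ (y * (n ∸ k) <? z))         ≡⟨ cong (y *_) (sumℕ-cong n (λ k k<n → cong (λ m → χ (y * m <? z)) (+-∸-assoc 1 k<n))) ⟩
    y * (∑ℕ[ k < n ] χ (y * suc (n ∸ suc k) <? z)) ≡⟨ cong (y *_) (sumℕ-reverse n (λ x → χ (y * suc x <? z))) ⟩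
    y * (∑ℕ[ x < n ] χ (y * suc x <? z))           ≤⟨ *-monoʳ-≤ y (sumℕ-mono-≤ n (λ x _ → χ-mono (y * suc x <? z) (y * x <? z) (≤-<-trans (*-monoʳ-≤ y (n≤1+n x))))) ⟩
    y * (∑ℕ[ x < n ] χ (y * x <? z))               ≤⟨ count-*< y z n ⟩
    z + y                                          ∎
    where open ≤-Reasoning

  count-*<-lower : ∀ t z n → z ≤ t * n → z ≤ t * (∑ℕ[ k < n ] χ (t * k <? z))
  count-*<-lower t z zero    z≤0 = z≤0
  count-*<-lower t z (suc n) z≤t[1+n] with z ≤? t * n
  ... | yes z≤tn = ≤-trans (count-*<-lower t z n z≤tn) (*-monoʳ-≤ t (m≤m+n _ _))
  ... | no  z≰tn = begin
    z                                                         ≤⟨ z≤t[1+n] ⟩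
    t * suc n                                                 ≡⟨ cong (t *_) (+-comm 1 n) ⟩
    t * (n + 1)                                               ≡⟨ cong₂ (λ c d → t * (c + d)) (sym (count-all n (λ k → t * k <? z) tk<z)) (sym (χ-yes (t * n <? z) (≰⇒> z≰tn))) ⟩
    t * ((∑ℕ[ k < n ] χ (t * k <? z)) + χ (t * n <? z))       ∎
    where
    open ≤-Reasoning
    tk<z : ∀ k → k < n → t * k < z
    tk<z k k<n = ≤-<-trans (*-monoʳ-≤ t (<⇒≤ k<n)) (≰⇒> z≰tn)

  count-injective : ∀ {n} M {A : Fin n → Set a} {B : ℕ → Set b} (A? : ∀ i → Dec (A i)) (B? : ∀ x → Dec (B x)) (f : Fin n → ℕ) →
                    (∀ i → A i → f i < M × B (f i)) → (∀ i j → A i → A j → f i ≡ f j → i ≡ j) →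
                    sum (λ i → χ (A? i)) ≤ (∑ℕ[ x < M ] χ (B? x))
  count-injective {n = zero}  M A? B? f maps inj = z≤n
  count-injective {n = suc n} M {B = B} A? B? f maps inj with A? zero
  ... | no _   = count-injective M (A? ∘ suc) B? (f ∘ suc) (maps ∘ suc) (λ i j ai aj → Finₚ.suc-injective ∘ inj (suc i) (suc j) ai aj)
  ... | yes a₀ = begin
    1 + sum (λ i → χ (A? (suc i)))                            ≤⟨ +-monoʳ-≤ 1 rest ⟩
    1 + (∑ℕ[ x < M ] χ (B′? x))                               ≡⟨ cong (_+ sumℕ M (χ ∘ B′?)) (count-≡ M (f zero) (proj₁ (maps zero a₀))) ⟨
    (∑ℕ[ x < M ] χ (x ≟ f zero)) + (∑ℕ[ x < M ] χ (B′? x))    ≡⟨ sumℕ-distrib-+ M _ _ ⟨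
    (∑ℕ[ x < M ] (χ (x ≟ f zero) + χ (B′? x)))               ≡⟨ sumℕ-cong M (λ x _ → χ-split (B? x) (x ≟ f zero) (λ { refl → proj₂ (maps zero a₀) })) ⟨
    (∑ℕ[ x < M ] χ (B? x))                                    ∎
    where
    open ≤-Reasoning
    B′? : ∀ x → Dec (B x × ¬ x ≡ f zero)
    B′? x = B? x ×-dec ¬? (x ≟ f zero)
    rest : sum (λ i → χ (A? (suc i))) ≤ (∑ℕ[ x < M ] χ (B′? x))
    rest = count-injective M (A? ∘ suc) B′? (f ∘ suc)
      (λ i ai → let (fi<M , bfi) = maps (suc i) ai in fi<M , bfi , λ fi≡f₀ → case inj (suc i) zero ai a₀ fi≡f₀ of λ ())
      (λ i j ai aj → Finₚ.suc-injective ∘ inj (suc i) (suc j) ai aj)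

  module FirstOccurrence {n} (w : Fin n → ℕ) where

    Repeated : Fin n → Set
    Repeated i = ∃ λ j → toℕ j < toℕ i × w j ≡ w i

    repeated? : ∀ i → Dec (Repeated i)
    repeated? i = any? (λ j → (toℕ j <? toℕ i) ×-dec (w j ≟ w i))

    firstOccurrence : ∀ i → ∃ λ r → w r ≡ w i × ¬ Repeated r
    firstOccurrence i = search (suc (toℕ i)) i ≤-refl
      where
      search : ∀ fuel i → toℕ i < fuel → ∃ λ r → w r ≡ w i × ¬ Repeated r
      search (suc fuel) i i<fuel with repeated? i
      ... | no ¬rep = i , refl , ¬rep
      ... | yes (j , j<i , wj≡wi) with search fuel j (≤-trans j<i (≤-pred i<fuel))
      ...   | r , wr≡wj , ¬rep = r , trans wr≡wj wj≡wi , ¬rep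

    firstOccurrence-injective : ∀ i j → ¬ Repeated i → ¬ Repeated j → w i ≡ w j → i ≡ j
    firstOccurrence-injective i j ¬rep-i ¬rep-j wi≡wj with <-cmp (toℕ i) (toℕ j)
    ... | tri< i<j _ _ = ⊥-elim (¬rep-j (i , i<j , wi≡wj))
    ... | tri≈ _ i≡j _ = toℕ-injective i≡j
    ... | tri> _ _ j<i = ⊥-elim (¬rep-i (j , j<i , sym wi≡wj))

  -- An index whose w-value already occurred has the same core as its first occurrence,
  -- whose bad set contains that core too; so its core is counted twice in ∑ |Bad i|.
  module UnionCount {n} (L : ℕ) (w : Fin n → ℕ)
    {Bad : Fin n → ℕ → Set a} (bad? : ∀ i k → Dec (Bad i k))
    {Core : ℕ → ℕ → Set b} (core? : ∀ x k → Dec (Core x k))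
    (core⊆bad : ∀ i k → Core (w i) k → Bad i k) where

    open FirstOccurrence w

    AnyBad : ℕ → Set a
    AnyBad k = ∃ λ i → Bad i k

    anyBad? : ∀ k → Dec (AnyBad k)
    anyBad? k = any? (λ i → bad? i k)

    private
      repeatedCore? : ∀ i k → Dec (Repeated i × Core (w i) k)
      repeatedCore? i k = repeated? i ×-dec core? (w i) k

      uncovered? : ∀ i k → Dec (Bad i k × ¬ (Repeated i × Core (w i) k))
      uncovered? i k = bad? i k ×-dec ¬? (repeatedCore? i k)

      uncovered : ∀ k → AnyBad k → ∃ λ i → Bad i k × ¬ (Repeated i × Core (w i) k)
      uncovered k (i , bad) with repeatedCore? i k
      ... | no ¬rc = i , bad , ¬rc
      ... | yes (_ , core) = let (r , wr≡wi , ¬rep) = firstOccurrence i in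
        r , core⊆bad r k (subst (λ x → Core x k) (sym wr≡wi) core) , ¬rep ∘ proj₁

      pointwise : ∀ k → χ (anyBad? k) + sum (λ i → χ (repeatedCore? i k)) ≤ sum (λ i → χ (bad? i k))
      pointwise k = begin
        χ (anyBad? k) + sum rc      ≤⟨ +-monoˡ-≤ (sum rc) (χ≤sum (anyBad? k)) ⟩
        sum unc + sum rc            ≡⟨ +-comm (sum unc) (sum rc) ⟩
        sum rc + sum unc            ≡⟨ ∑-distrib-+ rc unc ⟨
        sum (λ i → rc i + unc i)    ≡⟨ sum-cong-≗ (λ i → χ-split (bad? i k) (repeatedCore? i k) (λ (_ , core) → core⊆bad i k core)) ⟨
        sum (λ i → χ (bad? i k))    ∎
        where
        open ≤-Reasoning
        rc unc : Fin n → ℕ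
        rc i = χ (repeatedCore? i k)
        unc i = χ (uncovered? i k)
        χ≤sum : (d : Dec (AnyBad k)) → χ d ≤ sum unc
        χ≤sum (no _)   = z≤n
        χ≤sum (yes ab) = let (i , unc-i) = uncovered k ab in
          ≤-trans (≤-reflexive (sym (χ-yes (uncovered? i k) unc-i))) (≤-sum unc i)

    count-union : (∑ℕ[ k < L ] χ (anyBad? k)) + sum (λ i → χ (repeated? i) * (∑ℕ[ k < L ] χ (core? (w i) k)))
                  ≤ sum (λ i → ∑ℕ[ k < L ] χ (bad? i k))
    count-union = begin
      (∑ℕ[ k < L ] χ (anyBad? k)) + sum (λ i → χ (repeated? i) * (∑ℕ[ k < L ] χ (core? (w i) k)))
        ≡⟨ cong (#bad +_) (sum-cong-≗ λ i → trans (*-distribˡ-sumℕ L (χ (repeated? i)) (χ ∘ core? (w i))) (sumℕ-cong L (λ k _ → sym (χ-× (repeated? i) (core? (w i) k))))) ⟩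
      (∑ℕ[ k < L ] χ (anyBad? k)) + sum (λ i → ∑ℕ[ k < L ] χ (repeatedCore? i k))
        ≡⟨ cong (#bad +_) (sum-sumℕ-comm L (λ i k → χ (repeatedCore? i k))) ⟨
      (∑ℕ[ k < L ] χ (anyBad? k)) + (∑ℕ[ k < L ] sum (λ i → χ (repeatedCore? i k)))
        ≡⟨ sumℕ-distrib-+ L (χ ∘ anyBad?) (λ k → sum (λ i → χ (repeatedCore? i k))) ⟨
      (∑ℕ[ k < L ] (χ (anyBad? k) + sum (λ i → χ (repeatedCore? i k))))
        ≤⟨ sumℕ-mono-≤ L (λ k _ → pointwise k) ⟩
      (∑ℕ[ k < L ] sum (λ i → χ (bad? i k)))
        ≡⟨ sum-sumℕ-comm L (λ i k → χ (bad? i k)) ⟩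
      sum (λ i → ∑ℕ[ k < L ] χ (bad? i k))
        ∎
      where
      open ≤-Reasoning
      #bad : ℕ
      #bad = ∑ℕ[ k < L ] χ (anyBad? k)

  sumℕ-multiples : ∀ a q (h : ℕ → ℕ) → (∑ℕ[ x < q * suc a ] χ (suc a ∣? x) * h (x / suc a)) ≡ sumℕ q h
  sumℕ-multiples a zero    h = refl
  sumℕ-multiples a (suc q) h = begin
    sumℕ (suc a + q * suc a) F                                   ≡⟨ sumℕ-++ (suc a) (q * suc a) F ⟩
    sumℕ (suc a) F + (∑ℕ[ x < q * suc a ] F (suc a + x))         ≡⟨ cong₂ _+_ firstBlock (sumℕ-cong (q * suc a) (λ x _ → shifted x)) ⟩
    h 0 + (∑ℕ[ x < q * suc a ] χ (suc a ∣? x) * h (suc (x / suc a))) ≡⟨ cong (h 0 +_) (sumℕ-multiples a q (h ∘ suc)) ⟩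
    h 0 + (∑ℕ[ y < q ] h (suc y))                                ≡⟨ sumℕ-suc q h ⟨
    sumℕ (suc q) h                                               ∎
    where
    open ≡-Reasoning
    F : ℕ → ℕ
    F x = χ (suc a ∣? x) * h (x / suc a)
    firstBlock : sumℕ (suc a) F ≡ h 0
    firstBlock = begin
      sumℕ (suc a) F                  ≡⟨ sumℕ-suc a F ⟩
      F 0 + (∑ℕ[ k < a ] F (suc k))   ≡⟨ cong₂ _+_ (cong₂ _*_ (χ-yes (suc a ∣? 0) (suc a ∣0)) (cong h (0/n≡0 (suc a))))
                                                   (sumℕ-cong a (λ k k<a → cong (_* h (suc k / suc a)) (χ-no (suc a ∣? suc k) (λ a+1∣k+1 → <-irrefl refl (≤-trans (s≤s k<a) (∣⇒≤ a+1∣k+1)))))) ⟩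
      1 * h 0 + sumℕ a (λ _ → 0)      ≡⟨ cong (1 * h 0 +_) (trans (sumℕ-const a 0) (*-zeroʳ a)) ⟩
      1 * h 0 + 0                     ≡⟨ trans (+-identityʳ (1 * h 0)) (*-identityˡ (h 0)) ⟩
      h 0                             ∎
    shifted : ∀ x → F (suc a + x) ≡ χ (suc a ∣? x) * h (suc (x / suc a))
    shifted x = cong₂ _*_ (χ-cong (suc a ∣? (suc a + x)) (suc a ∣? x) (λ d → ∣m+n∣m⇒∣n d ∣-refl) (∣m∣n⇒∣m+n ∣-refl))
                          (cong h (trans (m/n≡1+[m∸n]/n (m≤m+n (suc a) x)) (cong (λ m → suc (m / suc a)) (m+n∸m≡n (suc a) x))))

  -- Each dyadic block 2^i ≤ a < 2^(i+1) contributes at least P / 2.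
  harmonic-lower : ∀ P j → (∀ i → i ≤ j → 2 ^ i ∣ P) → j * P ≤ 2 * (∑ℕ[ a < 2 ^ j ] P / suc a)
  harmonic-lower P zero    _     = z≤n
  harmonic-lower P (suc j) 2^i∣P with 2^i∣P (suc j) ≤-refl
  ... | divides m P≡m*2^[1+j] = begin
    P + j * P                                                       ≤⟨ +-mono-≤ (≤-reflexive P≡2*2^j*m) (harmonic-lower P j (λ i i≤j → 2^i∣P i (m≤n⇒m≤1+n i≤j))) ⟩
    2 * (2 ^ j * m) + 2 * sumℕ (2 ^ j) f                            ≤⟨ +-monoˡ-≤ _ (*-monoʳ-≤ 2 upperBlock) ⟩
    2 * (∑ℕ[ k < 2 ^ j ] f (2 ^ j + k)) + 2 * sumℕ (2 ^ j) f        ≡⟨ regroup ∑upper (sumℕ (2 ^ j) f) ⟩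
    2 * (sumℕ (2 ^ j) f + (∑ℕ[ k < 2 ^ j ] f (2 ^ j + k)))          ≡⟨ cong (2 *_) (sumℕ-++ (2 ^ j) (2 ^ j) f) ⟨
    2 * sumℕ (2 ^ j + 2 ^ j) f                                      ≡⟨ cong (λ m → 2 * sumℕ (2 ^ j + m) f) (+-identityʳ (2 ^ j)) ⟨
    2 * sumℕ (2 ^ suc j) f                                          ∎
    where
    open ≤-Reasoning
    f : ℕ → ℕ
    f a = P / suc a
    ∑upper : ℕ
    ∑upper = ∑ℕ[ k < 2 ^ j ] f (2 ^ j + k)
    P≡2*2^j*m : P ≡ 2 * (2 ^ j * m)
    P≡2*2^j*m = trans P≡m*2^[1+j] (reassoc m (2 ^ j))
      where
      reassoc : ∀ m t → m * (t + (t + 0)) ≡ 2 * (t * m)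
      reassoc = solve-∀
    regroup : ∀ u s → 2 * u + 2 * s ≡ 2 * (s + u)
    regroup = solve-∀
    upperBlock : 2 ^ j * m ≤ ∑upper
    upperBlock = begin
      2 ^ j * m                  ≡⟨ sumℕ-const (2 ^ j) m ⟨
      (∑ℕ[ _ < 2 ^ j ] m)        ≤⟨ sumℕ-mono-≤ (2 ^ j) (λ k k<2^j → m≤f k (+-monoʳ-≤ (2 ^ j) k<2^j)) ⟩
      ∑upper                     ∎
      where
      m≤f : ∀ k → 2 ^ j + suc k ≤ 2 ^ j + 2 ^ j → m ≤ f (2 ^ j + k)
      m≤f k bound = begin
        m                                        ≡⟨ m*n/n≡m m (suc (2 ^ j + k)) ⟨
        m * suc (2 ^ j + k) / suc (2 ^ j + k)    ≤⟨ /-monoˡ-≤ (suc (2 ^ j + k)) (*-monoʳ-≤ m (subst₂ _≤_ (+-suc (2 ^ j) k) (cong (2 ^ j +_) (sym (+-identityʳ (2 ^ j)))) bound)) ⟩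
        m * 2 ^ suc j / suc (2 ^ j + k)          ≡⟨ cong (_/ suc (2 ^ j + k)) P≡m*2^[1+j] ⟨
        P / suc (2 ^ j + k)                      ∎

  module Rough (P : ℕ) {{_ : NonZero P}} where

    strip : ℕ → ℕ
    strip w = quotient (gcd[m,n]∣m w P)

    strip-eq : ∀ w → w ≡ strip w * gcd w P
    strip-eq w = _∣_.equality (gcd[m,n]∣m w P)

    strip-coprime : ∀ {w} → gcd w P ≡ 1 → strip w ≡ w
    strip-coprime {w} gcd≡1 = sym (trans (strip-eq w) (trans (cong (strip w *_) gcd≡1) (*-identityʳ _)))

    stripⁿ : ℕ → ℕ → ℕ
    stripⁿ zero    w = w
    stripⁿ (suc e) w = stripⁿ e (strip w)

    stripⁿ-coprime : ∀ e {w} → gcd w P ≡ 1 → stripⁿ e w ≡ w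
    stripⁿ-coprime zero    gcd≡1 = refl
    stripⁿ-coprime (suc e) gcd≡1 = trans (cong (stripⁿ e) (strip-coprime gcd≡1)) (stripⁿ-coprime e gcd≡1)

    stripⁿ-factor : ∀ e w → ∃ λ s → s ≤ P ^ e × w ≡ s * stripⁿ e w
    stripⁿ-factor zero    w = 1 , ≤-refl , sym (*-identityˡ w)
    stripⁿ-factor (suc e) w with stripⁿ-factor e (strip w)
    ... | s , s≤P^e , eq = gcd w P * s , *-mono-≤ (gcd[m,n]≤n w P) s≤P^e , (begin
      w                                   ≡⟨ strip-eq w ⟩
      strip w * gcd w P                   ≡⟨ cong (_* gcd w P) eq ⟩
      s * stripⁿ e (strip w) * gcd w P    ≡⟨ rotate s (stripⁿ e (strip w)) (gcd w P) ⟩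
      gcd w P * s * stripⁿ e (strip w)    ∎)
      where
      open ≡-Reasoning
      rotate : ∀ a b c → a * b * c ≡ c * a * b
      rotate = solve-∀

    stripⁿ-coprime-or-small : ∀ e w → Coprime (stripⁿ e w) P ⊎ 2 ^ e * stripⁿ e w ≤ w
    stripⁿ-coprime-or-small zero    w = inj₂ (≤-reflexive (*-identityˡ w))
    stripⁿ-coprime-or-small (suc e) w with gcd w P ≟ 1
    ... | yes gcd≡1 = inj₁ (subst (λ x → Coprime x P) (sym (stripⁿ-coprime (suc e) {w} gcd≡1)) (gcd≡1⇒coprime gcd≡1))
    ... | no  gcd≢1 with stripⁿ-coprime-or-small e (strip w)
    ...   | inj₁ coprime = inj₁ coprime
    ...   | inj₂ small   = inj₂ (begin
      2 * 2 ^ e * stripⁿ e (strip w)    ≡⟨ *-assoc 2 (2 ^ e) _ ⟩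
      2 * (2 ^ e * stripⁿ e (strip w))  ≤⟨ *-monoʳ-≤ 2 small ⟩
      2 * strip w                       ≤⟨ *-monoˡ-≤ (strip w) 2≤gcd ⟩
      gcd w P * strip w                 ≡⟨ *-comm (gcd w P) (strip w) ⟩
      strip w * gcd w P                 ≡⟨ strip-eq w ⟨
      w                                 ∎)
      where
      open ≤-Reasoning
      2≤gcd : 2 ≤ gcd w P
      2≤gcd with gcd w P | gcd[m,n]≢0 w P (inj₂ (≢-nonZero⁻¹ P))
      ... | zero          | gcd≢0 = ⊥-elim (gcd≢0 refl)
      ... | suc zero      | _     = ⊥-elim (gcd≢1 refl)
      ... | suc (suc _)   | _     = s≤s (s≤s z≤n)

    cofactor-unique : ∀ {a b x y} → a ∣ P → b ∣ P → Coprime x P → Coprime y P → a * x ≡ b * y → a ≡ b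
    cofactor-unique {a} {b} {x} {y} a∣P b∣P x⊥P y⊥P ax≡by =
      ∣-antisym (divides-other {x = x} a∣P y⊥P (trans (*-comm y b) (trans (sym ax≡by) (*-comm a x))))
                (divides-other {x = y} b∣P x⊥P (trans (*-comm x a) (trans ax≡by (*-comm b y))))
      where
      divides-other : ∀ {a b x y} → a ∣ P → Coprime y P → y * b ≡ x * a → a ∣ b
      divides-other {x = x} a∣P y⊥P eq = coprime-divisor (λ (d∣a , d∣y) → y⊥P (d∣y , ∣-trans d∣a a∣P)) (divides x eq)

    #coprime : ℕ → ℕ
    #coprime N = ∑ℕ[ x < N ] χ (coprime? x P)

    #coprime-*P : ∀ q → #coprime (q * P) ≡ q * #coprime P
    #coprime-*P q = sumℕ-periodic q P (λ x → χ (coprime? x P))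
      (λ x → χ-cong (coprime? (P + x) P) (coprime? x P)
                    (λ coprime (d∣x , d∣P) → coprime (∣m∣n⇒∣m+n d∣P d∣x , d∣P)) coprime-+)

    #coprime-mono : ∀ {M N} → M ≤ N → #coprime M ≤ #coprime N
    #coprime-mono {M} M≤N with m≤n⇒∃[o]m+o≡n M≤N
    ... | o , refl = ≤-trans (m≤m+n (#coprime M) _) (≤-reflexive (sym (sumℕ-++ M o (λ x → χ (coprime? x P)))))

    module _ (K : ℕ) (divides-P : ∀ a → a < K → suc a ∣ P) where

      private
        hit? : (a x : ℕ) → Dec (suc a ∣ x × Coprime (x / suc a) P)
        hit? a x = suc a ∣? x ×-dec coprime? (x / suc a) P

        hit-unique : ∀ x a b → a < K → b < K → (suc a ∣ x × Coprime (x / suc a) P) → (suc b ∣ x × Coprime (x / suc b) P) → a ≡ b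
        hit-unique x a b a<K b<K (a+1∣x , x/a+1⊥P) (b+1∣x , x/b+1⊥P) =
          suc-injective (cofactor-unique (divides-P a a<K) (divides-P b b<K) x/a+1⊥P x/b+1⊥P
                                          (trans (m*[n/m]≡n a+1∣x) (sym (m*[n/m]≡n b+1∣x))))

        #hits : ∀ a → a < K → (∑ℕ[ x < P * P ] χ (hit? a x)) ≡ P / suc a * #coprime P
        #hits a a<K = begin
          (∑ℕ[ x < P * P ] χ (hit? a x))                                        ≡⟨ cong (λ m → ∑ℕ[ x < m ] χ (hit? a x)) P*P≡ ⟩
          (∑ℕ[ x < P * q * suc a ] χ (hit? a x))                                ≡⟨ sumℕ-cong (P * q * suc a) (λ x _ → χ-× (suc a ∣? x) (coprime? (x / suc a) P)) ⟩
          (∑ℕ[ x < P * q * suc a ] χ (suc a ∣? x) * χ (coprime? (x / suc a) P)) ≡⟨ sumℕ-multiples a (P * q) (λ y → χ (coprime? y P)) ⟩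
          #coprime (P * q)                                                      ≡⟨ cong #coprime (*-comm P q) ⟩
          #coprime (q * P)                                                      ≡⟨ #coprime-*P q ⟩
          q * #coprime P                                                        ∎
          where
          open ≡-Reasoning
          q = P / suc a
          P*P≡ : P * P ≡ P * q * suc a
          P*P≡ = trans (cong (P *_) (sym (m/n*n≡m (divides-P a a<K)))) (sym (*-assoc P q (suc a)))

      -- x < P * P is hit by at most one a: in x = suc a * y with y coprime to P, the factor
      -- suc a is determined by x (cofactor-unique).
      #coprime-harmonic : #coprime P * (∑ℕ[ a < K ] P / suc a) ≤ P * P
      #coprime-harmonic = begin
        #coprime P * (∑ℕ[ a < K ] P / suc a)              ≡⟨ *-distribˡ-sumℕ K (#coprime P) (λ a → P / suc a) ⟩
        (∑ℕ[ a < K ] #coprime P * (P / suc a))            ≡⟨ sumℕ-cong K (λ a a<K → trans (*-comm (#coprime P) _) (sym (#hits a a<K))) ⟩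
        (∑ℕ[ a < K ] ∑ℕ[ x < P * P ] χ (hit? a x))        ≡⟨ sumℕ-comm (P * P) K (λ a x → χ (hit? a x)) ⟨
        (∑ℕ[ x < P * P ] ∑ℕ[ a < K ] χ (hit? a x))        ≤⟨ sumℕ-mono-≤ (P * P) (λ x _ → count-≤1 K (λ a → hit? a x) (λ a b a<K b<K → hit-unique x a b a<K b<K)) ⟩
        (∑ℕ[ x < P * P ] 1)                               ≡⟨ trans (sumℕ-const (P * P) 1) (*-identityʳ (P * P)) ⟩
        P * P                                             ∎
        where open ≤-Reasoning

    #coprime-density : ∀ j → (∀ a → a < 2 ^ j → suc a ∣ P) → j * #coprime P ≤ 2 * P
    #coprime-density j divides-P = *-cancelʳ-≤ (j * #coprime P) (2 * P) P (begin
      j * #coprime P * P              ≡⟨ reorder j (#coprime P) P ⟩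
      #coprime P * (j * P)            ≤⟨ *-monoʳ-≤ (#coprime P) (harmonic-lower P j 2^i∣P) ⟩
      #coprime P * (2 * ∑harmonic)    ≡⟨ *-left-comm (#coprime P) 2 ∑harmonic ⟩
      2 * (#coprime P * ∑harmonic)    ≤⟨ *-monoʳ-≤ 2 (#coprime-harmonic (2 ^ j) divides-P) ⟩
      2 * (P * P)                     ≡⟨ *-assoc 2 P P ⟨
      2 * P * P                       ∎)
      where
      open ≤-Reasoning
      ∑harmonic : ℕ
      ∑harmonic = ∑ℕ[ a < 2 ^ j ] P / suc a
      2^i∣P : ∀ i → i ≤ j → 2 ^ i ∣ P
      2^i∣P i i≤j = subst (_∣ P) (suc-pred (2 ^ i) {{m^n≢0 2 i}})
                          (divides-P (pred (2 ^ i)) (≤-trans (≤-reflexive (suc-pred (2 ^ i) {{m^n≢0 2 i}})) (^-monoʳ-≤ 2 i≤j)))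
      reorder : ∀ j r p → j * r * p ≡ r * (j * p)
      reorder = solve-∀

    #coprime-bound : ∀ j → (∀ a → a < 2 ^ j → suc a ∣ P) → ∀ N → j * #coprime N ≤ 2 * (N + P)
    #coprime-bound j divides-P N = begin
      j * #coprime N                 ≤⟨ *-monoʳ-≤ j (#coprime-mono (<⇒≤ N<[q+1]P)) ⟩
      j * #coprime (suc q * P)       ≡⟨ cong (j *_) (#coprime-*P (suc q)) ⟩
      j * (suc q * #coprime P)       ≡⟨ *-left-comm j (suc q) (#coprime P) ⟩
      suc q * (j * #coprime P)       ≤⟨ *-monoʳ-≤ (suc q) (#coprime-density j divides-P) ⟩
      suc q * (2 * P)                ≡⟨ expand q P ⟩
      2 * (q * P + P)                ≤⟨ *-monoʳ-≤ 2 (+-monoˡ-≤ P (m/n*n≤m N P)) ⟩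
      2 * (N + P)                    ∎
      where
      open ≤-Reasoning
      q = N / P
      N<[q+1]P : N < suc q * P
      N<[q+1]P = begin-strict
        N              ≡⟨ m≡m%n+[m/n]*n N P ⟩
        N % P + q * P  <⟨ +-monoˡ-< (q * P) (m%n<n N P) ⟩
        P + q * P      ∎
      expand : ∀ q p → suc q * (2 * p) ≡ 2 * (q * p + p)
      expand = solve-∀

  -- The distance from z to the nearest multiple of L, i.e. L · ‖ z / L ‖.
  cdist : (L : ℕ) → {{NonZero L}} → ℕ → ℕ
  cdist L z = (z % L) ⊓ (L ∸ z % L)

  module _ (L : ℕ) {{_ : NonZero L}} where

    cdist-+-* : ∀ z q → cdist L (z + q * L) ≡ cdist L z
    cdist-+-* z q = cong (λ r → r ⊓ (L ∸ r)) ([m+kn]%n≡m%n z q L)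

    cdist≤ : ∀ z → cdist L z ≤ z
    cdist≤ z = ≤-trans (m⊓n≤m _ _) (m%n≤m z L)

    cdist≤complement : ∀ z u → L ∣ z + u → cdist L z ≤ u
    cdist≤complement z u L∣z+u with z % L ≟ 0
    ... | yes r≡0 = ≤-trans (m⊓n≤m _ _) (≤-trans (≤-reflexive r≡0) z≤n)
    ... | no  r≢0 = begin
      cdist L z        ≤⟨ m⊓n≤n _ _ ⟩
      L ∸ z % L        ≤⟨ ∸-monoˡ-≤ (z % L) (∣⇒≤ {{r+u≢0}} L∣r+u) ⟩
      z % L + u ∸ z % L ≡⟨ m+n∸m≡n (z % L) u ⟩
      u                ∎
      where
      open ≤-Reasoning
      swap : ∀ r m u → r + m + u ≡ m + (r + u)
      swap = solve-∀
      L∣r+u : L ∣ z % L + u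
      L∣r+u = ∣m+n∣m⇒∣n (subst (L ∣_) (trans (cong (_+ u) (m≡m%n+[m/n]*n z L)) (swap (z % L) (z / L * L) u)) L∣z+u)
                        (n∣m*n (z / L))
      r+u≢0 : NonZero (z % L + u)
      r+u≢0 = ≢-nonZero (r≢0 ∘ m+n≡0⇒m≡0 (z % L))

    cdist-*-≤ : ∀ s y → cdist L (s * y) ≤ s * cdist L y
    cdist-*-≤ s y = ≤-trans (≤-reflexive reduce) (bound (r ≤? L ∸ r))
      where
      open ≤-Reasoning
      r = y % L
      distrib : ∀ s r q l → s * (r + q * l) ≡ s * r + s * q * l
      distrib = solve-∀
      reduce : cdist L (s * y) ≡ cdist L (s * r)
      reduce = trans (cong (cdist L) (trans (cong (s *_) (m≡m%n+[m/n]*n y L)) (distrib s r (y / L) L)))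
                     (cdist-+-* (s * r) (s * (y / L)))
      bound : Dec (r ≤ L ∸ r) → cdist L (s * r) ≤ s * cdist L y
      bound (yes r≤L∸r) = begin
        cdist L (s * r)       ≤⟨ cdist≤ (s * r) ⟩
        s * r                 ≡⟨ cong (s *_) (m≤n⇒m⊓n≡m r≤L∸r) ⟨
        s * (r ⊓ (L ∸ r))     ∎
      bound (no r≰L∸r) = begin
        cdist L (s * r)       ≤⟨ cdist≤complement (s * r) (s * (L ∸ r)) (divides s sr+s[L∸r]≡sL) ⟩
        s * (L ∸ r)           ≡⟨ cong (s *_) (m≥n⇒m⊓n≡n (<⇒≤ (≰⇒> r≰L∸r))) ⟨
        s * (r ⊓ (L ∸ r))     ∎
        where
        sr+s[L∸r]≡sL : s * r + s * (L ∸ r) ≡ s * L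
        sr+s[L∸r]≡sL = trans (sym (*-distribˡ-+ s r (L ∸ r))) (cong (s *_) (m+[n∸m]≡n (<⇒≤ (m%n<n y L))))

    module _ {v : ℕ} (v∣L : v ∣ L) where

      private
        Q : ℕ
        Q = quotient v∣L

        L≡Qv : L ≡ Q * v
        L≡Qv = _∣_.equality v∣L

        instance
          v≢0 : NonZero v
          v≢0 = ≢-nonZero λ { refl → ≢-nonZero⁻¹ L (trans L≡Qv (*-zeroʳ Q)) }

        kv<L : ∀ {k} → k < Q → k * v < L
        kv<L k<Q = subst (_ <_) (sym L≡Qv) (*-monoˡ-< v k<Q)

      cdist-multiple : ∀ k → k < Q → cdist L (k * v) ≡ (k ⊓ (Q ∸ k)) * v
      cdist-multiple k k<Q = begin
        (k * v % L) ⊓ (L ∸ k * v % L)   ≡⟨ cong (λ r → r ⊓ (L ∸ r)) (m<n⇒m%n≡m (kv<L k<Q)) ⟩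
        (k * v) ⊓ (L ∸ k * v)           ≡⟨ cong (λ l → (k * v) ⊓ (l ∸ k * v)) L≡Qv ⟩
        (k * v) ⊓ (Q * v ∸ k * v)       ≡⟨ cong ((k * v) ⊓_) (*-distribʳ-∸ v Q k) ⟨
        (k * v) ⊓ ((Q ∸ k) * v)         ≡⟨ *-distribʳ-⊓ v k (Q ∸ k) ⟨
        (k ⊓ (Q ∸ k)) * v               ∎
        where open ≡-Reasoning

      sumℕ-cdist-multiples : ∀ (g : ℕ → ℕ) → (∑ℕ[ k < L ] g (cdist L (k * v))) ≡ v * (∑ℕ[ k < Q ] g ((k ⊓ (Q ∸ k)) * v))
      sumℕ-cdist-multiples g = begin
        (∑ℕ[ k < L ] g (cdist L (k * v)))             ≡⟨ cong (λ l → ∑ℕ[ k < l ] g (cdist L (k * v))) (trans L≡Qv (*-comm Q v)) ⟩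
        (∑ℕ[ k < v * Q ] g (cdist L (k * v)))         ≡⟨ sumℕ-periodic v Q _ (λ k → cong g (periodic k)) ⟩
        v * (∑ℕ[ k < Q ] g (cdist L (k * v)))         ≡⟨ cong (v *_) (sumℕ-cong Q (λ k k<Q → cong g (cdist-multiple k k<Q))) ⟩
        v * (∑ℕ[ k < Q ] g ((k ⊓ (Q ∸ k)) * v))       ∎
        where
        open ≡-Reasoning
        periodic : ∀ k → cdist L ((Q + k) * v) ≡ cdist L (k * v)
        periodic k = trans (cong (cdist L) (trans (*-distribʳ-+ v Q k) (trans (+-comm (Q * v) (k * v)) (cong (k * v +_) (trans (sym L≡Qv) (sym (*-identityˡ L)))))))
                           (cdist-+-* (k * v) 1)

      count-cdist-upper : ∀ X Y → Y * (∑ℕ[ k < L ] χ (Y * cdist L (k * v) <? X * L)) ≤ 2 * (X * L) + 2 * (Y * v)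
      count-cdist-upper X Y = begin
        Y * (∑ℕ[ k < L ] χ (Y * cdist L (k * v) <? X * L))                 ≡⟨ cong (Y *_) (sumℕ-cdist-multiples (λ m → χ (Y * m <? X * L))) ⟩
        Y * (v * (∑ℕ[ k < Q ] χ (Y * ((k ⊓ (Q ∸ k)) * v) <? X * L)))       ≡⟨ cong (λ c → Y * (v * c)) (sumℕ-cong Q (λ k _ → cancel-v (k ⊓ (Q ∸ k)))) ⟩
        Y * (v * (∑ℕ[ k < Q ] χ (Y * (k ⊓ (Q ∸ k)) <? X * Q)))              ≡⟨ *-left-comm Y v _ ⟩
        v * (Y * (∑ℕ[ k < Q ] χ (Y * (k ⊓ (Q ∸ k)) <? X * Q)))              ≤⟨ *-monoʳ-≤ v twoEnds ⟩
        v * ((X * Q + Y) + (X * Q + Y))                                     ≡⟨ expand v X Q Y ⟩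
        2 * (X * (Q * v)) + 2 * (Y * v)                                     ≡⟨ cong (λ l → 2 * (X * l) + 2 * (Y * v)) L≡Qv ⟨
        2 * (X * L) + 2 * (Y * v)                                           ∎
        where
        open ≤-Reasoning
        expand : ∀ v x q y → v * ((x * q + y) + (x * q + y)) ≡ 2 * (x * (q * v)) + 2 * (y * v)
        expand = solve-∀
        cancel-v : ∀ m → χ (Y * (m * v) <? X * L) ≡ χ (Y * m <? X * Q)
        cancel-v m = χ-cong (Y * (m * v) <? X * L) (Y * m <? X * Q)
          (λ lt → *-cancelʳ-< v (Y * m) (X * Q) (subst₂ _<_ (sym (*-assoc Y m v)) (trans (cong (X *_) L≡Qv) (sym (*-assoc X Q v))) lt))
          (λ lt → subst₂ _<_ (*-assoc Y m v) (trans (*-assoc X Q v) (cong (X *_) (sym L≡Qv))) (*-monoˡ-< v lt))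
        twoEnds : Y * (∑ℕ[ k < Q ] χ (Y * (k ⊓ (Q ∸ k)) <? X * Q)) ≤ (X * Q + Y) + (X * Q + Y)
        twoEnds = begin
          Y * (∑ℕ[ k < Q ] χ (Y * (k ⊓ (Q ∸ k)) <? X * Q))                                   ≤⟨ *-monoʳ-≤ Y (sumℕ-mono-≤ Q (λ k _ → either k)) ⟩
          Y * (∑ℕ[ k < Q ] (χ (Y * k <? X * Q) + χ (Y * (Q ∸ k) <? X * Q)))                  ≡⟨ cong (Y *_) (sumℕ-distrib-+ Q _ _) ⟩
          Y * ((∑ℕ[ k < Q ] χ (Y * k <? X * Q)) + (∑ℕ[ k < Q ] χ (Y * (Q ∸ k) <? X * Q)))    ≡⟨ *-distribˡ-+ Y _ _ ⟩
          Y * (∑ℕ[ k < Q ] χ (Y * k <? X * Q)) + Y * (∑ℕ[ k < Q ] χ (Y * (Q ∸ k) <? X * Q))  ≤⟨ +-mono-≤ (count-*< Y (X * Q) Q) (count-∸*< Y (X * Q) Q) ⟩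
          (X * Q + Y) + (X * Q + Y)                                                          ∎
          where
          either : ∀ k → χ (Y * (k ⊓ (Q ∸ k)) <? X * Q) ≤ χ (Y * k <? X * Q) + χ (Y * (Q ∸ k) <? X * Q)
          either k = ≤-trans (χ-mono (Y * (k ⊓ (Q ∸ k)) <? X * Q) (Y * k <? X * Q ⊎-dec Y * (Q ∸ k) <? X * Q) min<⇒either)
                             (χ-⊎ (Y * k <? X * Q) (Y * (Q ∸ k) <? X * Q))
            where
            min<⇒either : Y * (k ⊓ (Q ∸ k)) < X * Q → Y * k < X * Q ⊎ Y * (Q ∸ k) < X * Q
            min<⇒either lt with ⊓-sel k (Q ∸ k)
            ... | inj₁ eq = inj₁ (subst (λ m → Y * m < X * Q) eq lt)
            ... | inj₂ eq = inj₂ (subst (λ m → Y * m < X * Q) eq lt)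

      count-cdist-lower : ∀ X T → X ≤ T → X * L ≤ T * (∑ℕ[ k < L ] χ (T * cdist L (k * v) <? X * L))
      count-cdist-lower X T X≤T = begin
        X * L                                                       ≡⟨ cong (X *_) L≡Qv ⟩
        X * (Q * v)                                                 ≡⟨ rotate X Q v ⟩
        v * (X * Q)                                                 ≤⟨ *-monoʳ-≤ v (count-*<-lower T (X * Q) Q (*-monoˡ-≤ Q X≤T)) ⟩
        v * (T * (∑ℕ[ k < Q ] χ (T * k <? X * Q)))                  ≤⟨ *-monoʳ-≤ v (*-monoʳ-≤ T (sumℕ-mono-≤ Q (λ k _ → fold k))) ⟩
        v * (T * (∑ℕ[ k < Q ] χ (T * ((k ⊓ (Q ∸ k)) * v) <? X * L))) ≡⟨ *-left-comm v T _ ⟩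
        T * (v * (∑ℕ[ k < Q ] χ (T * ((k ⊓ (Q ∸ k)) * v) <? X * L))) ≡⟨ cong (T *_) (sumℕ-cdist-multiples (λ m → χ (T * m <? X * L))) ⟨
        T * (∑ℕ[ k < L ] χ (T * cdist L (k * v) <? X * L))           ∎
        where
        open ≤-Reasoning
        rotate : ∀ x q v → x * (q * v) ≡ v * (x * q)
        rotate = solve-∀
        fold : ∀ k → χ (T * k <? X * Q) ≤ χ (T * ((k ⊓ (Q ∸ k)) * v) <? X * L)
        fold k = χ-mono (T * k <? X * Q) (T * ((k ⊓ (Q ∸ k)) * v) <? X * L) λ lt → begin-strict
          T * ((k ⊓ (Q ∸ k)) * v)   ≤⟨ *-monoʳ-≤ T (*-monoˡ-≤ v (m⊓n≤m k (Q ∸ k))) ⟩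
          T * (k * v)               ≡⟨ *-assoc T k v ⟨
          T * k * v                 <⟨ *-monoˡ-< v lt ⟩
          X * Q * v                 ≡⟨ *-assoc X Q v ⟩
          X * (Q * v)               ≡⟨ cong (X *_) L≡Qv ⟨
          X * L                     ∎

  m≤n⇒m∣n! : ∀ {m n} → 1 ≤ m → m ≤ n → m ∣ n !
  m≤n⇒m∣n! {suc m} _ m<n = ∣-trans (m∣m*n (m !)) (m≤n⇒m!∣n! m<n)

  n<2^n : ∀ n → n < 2 ^ n
  n<2^n zero    = s≤s z≤n
  n<2^n (suc n) = subst (suc n <_) (cong (2 ^ n +_) (sym (+-identityʳ (2 ^ n)))) (+-mono-≤-< (m^n>0 2 n) (n<2^n n))

  -- j makes integers coprime to P sparse and E makes the remaining rough parts small, so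
  -- that at most n / 2 of the v i have distinct rough parts (2*#first≤n).
  module Parameters (C : ℕ) where

    j : ℕ
    j = 16 * C

    P : ℕ
    P = (2 ^ j) !

    instance
      P≢0 : NonZero P
      P≢0 = (2 ^ j) !≢0

    E : ℕ
    E = 8 * C

    S : ℕ
    S = P ^ E

    d : ℕ
    d = 4 * S

    instance
      d≢0 : NonZero d
      d≢0 = m*n≢0 4 S {{_}} {{m^n≢0 P E}}

    N₀ : ℕ
    N₀ = 1 + P + 2 ^ E

    S≥1 : 1 ≤ S
    S≥1 = m^n>0 P E

    divides-P : ∀ a → a < 2 ^ j → suc a ∣ P
    divides-P a a<2^j = m≤n⇒m∣n! (s≤s z≤n) a<2^j

    open Rough P public

  module DiscreteBound (C n : ℕ) (v : Fin n → ℕ) (C≥1 : 1 ≤ C) (n≥N₀ : Parameters.N₀ C ≤ n)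
                       (v≥1 : ∀ i → 1 ≤ v i) (v≤Cn : ∀ i → v i ≤ C * n) where

    open Parameters C

    X Y T : ℕ
    X = suc d
    Y = 2 * d * n
    T = Y * S

    Z : ℕ
    Z = 4 * S * Y * C * n

    -- The factor suc Z makes the boundary terms 2 Y (v i) of count-cdist-upper negligible.
    L : ℕ
    L = (C * n) ! * suc Z

    instance
      L≢0 : NonZero L
      L≢0 = m*n≢0 ((C * n) !) _ {{(C * n) !≢0}}

      Y≢0 : NonZero Y
      Y≢0 = m*n≢0 (2 * d) n {{m*n≢0 2 d}} {{>-nonZero (≤-trans (s≤s z≤n) n≥N₀)}}

    w : Fin n → ℕ
    w i = stripⁿ E (v i)

    v∣L : ∀ i → v i ∣ L
    v∣L i = ∣m⇒∣m*n _ (m≤n⇒m∣n! (v≥1 i) (v≤Cn i))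

    w≤v : ∀ i → w i ≤ v i
    w≤v i with stripⁿ-factor E (v i)
    ... | zero  , _ , v≡0     = ⊥-elim (<-irrefl (sym v≡0) (v≥1 i))
    ... | suc s , _ , v≡[1+s]w = subst (w i ≤_) (sym v≡[1+s]w) (m≤m+n (w i) (s * w i))

    w∣L : ∀ i → w i ∣ L
    w∣L i = ∣-trans (divides (proj₁ (stripⁿ-factor E (v i))) (proj₂ (proj₂ (stripⁿ-factor E (v i))))) (v∣L i)

    open FirstOccurrence w

    #first : ℕ
    #first = sum (λ i → χ (¬? (repeated? i)))

    #repeated : ℕ
    #repeated = sum (λ i → χ (repeated? i))

    2*#first≤n : 2 * #first ≤ n
    2*#first≤n = *-cancelˡ-≤ (8 * C) {{m*n≢0 8 C {{_}} {{>-nonZero C≥1}}}} (begin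
      8 * C * (2 * #first)                                ≡⟨ 8c*2r≡16cr C #first ⟩
      j * #first                                          ≤⟨ *-monoʳ-≤ j (count-injective M (¬? ∘ repeated?) roughOrSmall? w firstRoughOrSmall firstOccurrence-injective) ⟩
      j * (∑ℕ[ x < M ] χ (roughOrSmall? x))               ≤⟨ *-monoʳ-≤ j (sumℕ-mono-≤ M (λ x _ → χ-⊎ (coprime? x P) (2 ^ E * x ≤? C * n))) ⟩
      j * (∑ℕ[ x < M ] (χ (coprime? x P) + χ (small? x))) ≡⟨ cong (j *_) (sumℕ-distrib-+ M _ _) ⟩
      j * (#coprime M + #small)                           ≡⟨ *-distribˡ-+ j (#coprime M) #small ⟩
      j * #coprime M + j * #small                         ≤⟨ +-mono-≤ (#coprime-bound j divides-P M) (≤-reflexive (16cr≡2*8cr C #small)) ⟩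
      2 * (M + P) + 2 * (8 * C * #small)                  ≤⟨ +-monoʳ-≤ (2 * (M + P)) (*-monoʳ-≤ 2 (≤-trans (*-monoˡ-≤ #small (<⇒≤ (n<2^n E))) (count-*≤ (2 ^ E) (C * n) M))) ⟩
      2 * (M + P) + 2 * (C * n + 2 ^ E)                   ≡⟨ collect (C * n) P (2 ^ E) ⟩
      4 * (C * n) + 2 * N₀                                ≤⟨ +-monoʳ-≤ (4 * (C * n)) (*-monoʳ-≤ 2 (≤-trans n≥N₀ (m≤n*m n C {{>-nonZero C≥1}}))) ⟩
      4 * (C * n) + 2 * (C * n)                           ≤⟨ +-monoʳ-≤ (4 * (C * n)) (*-monoˡ-≤ (C * n) {2} {4} (s≤s (s≤s z≤n))) ⟩
      4 * (C * n) + 4 * (C * n)                           ≡⟨ eight C n ⟩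
      8 * C * n                                           ∎)
      where
      open ≤-Reasoning
      M : ℕ
      M = suc (C * n)
      small? : ∀ x → Dec (2 ^ E * x ≤ C * n)
      small? x = 2 ^ E * x ≤? C * n
      #small : ℕ
      #small = ∑ℕ[ x < M ] χ (small? x)
      roughOrSmall? : ∀ x → Dec (Coprime x P ⊎ 2 ^ E * x ≤ C * n)
      roughOrSmall? x = coprime? x P ⊎-dec small? x
      firstRoughOrSmall : ∀ i → ¬ Repeated i → w i < M × (Coprime (w i) P ⊎ 2 ^ E * w i ≤ C * n)
      firstRoughOrSmall i _ = s≤s (≤-trans (w≤v i) (v≤Cn i)) , map₂ (λ small → ≤-trans small (v≤Cn i)) (stripⁿ-coprime-or-small E (v i))
      8c*2r≡16cr : ∀ c r → 8 * c * (2 * r) ≡ 16 * c * r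
      8c*2r≡16cr = solve-∀
      16cr≡2*8cr : ∀ c r → 16 * c * r ≡ 2 * (8 * c * r)
      16cr≡2*8cr = solve-∀
      collect : ∀ cn p e → 2 * (suc cn + p) + 2 * (cn + e) ≡ 4 * cn + 2 * (1 + p + e)
      collect = solve-∀
      eight : ∀ c n → 4 * (c * n) + 4 * (c * n) ≡ 8 * c * n
      eight = solve-∀

    n≤2*#repeated : n ≤ 2 * #repeated
    n≤2*#repeated = +-cancelʳ-≤ (2 * #first) n (2 * #repeated) (begin
      n + 2 * #first                                ≤⟨ +-monoʳ-≤ n 2*#first≤n ⟩
      n + n                                         ≡⟨ cong (λ m → m + m) (count-compl repeated?) ⟨
      (#repeated + #first) + (#repeated + #first)   ≡⟨ double #repeated #first ⟩
      2 * #repeated + 2 * #first                    ∎)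
      where
      open ≤-Reasoning
      double : ∀ a b → (a + b) + (a + b) ≡ 2 * a + 2 * b
      double = solve-∀

    bad? : ∀ i k → Dec (Y * cdist L (k * v i) < X * L)
    bad? i k = Y * cdist L (k * v i) <? X * L

    core? : ∀ x k → Dec (T * cdist L (k * x) < X * L)
    core? x k = T * cdist L (k * x) <? X * L

    core⊆bad : ∀ i k → T * cdist L (k * w i) < X * L → Y * cdist L (k * v i) < X * L
    core⊆bad i k core = begin-strict
      Y * cdist L (k * v i)             ≡⟨ cong (λ m → Y * cdist L (k * m)) v≡sw ⟩
      Y * cdist L (k * (s * w i))       ≡⟨ cong (λ m → Y * cdist L m) (*-left-comm k s (w i)) ⟩
      Y * cdist L (s * (k * w i))       ≤⟨ *-monoʳ-≤ Y (cdist-*-≤ L s (k * w i)) ⟩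
      Y * (s * cdist L (k * w i))       ≤⟨ *-monoʳ-≤ Y (*-monoˡ-≤ _ s≤S) ⟩
      Y * (S * cdist L (k * w i))       ≡⟨ *-assoc Y S _ ⟨
      T * cdist L (k * w i)             <⟨ core ⟩
      X * L                             ∎
      where
      open ≤-Reasoning
      s = proj₁ (stripⁿ-factor E (v i))
      s≤S = proj₁ (proj₂ (stripⁿ-factor E (v i)))
      v≡sw = proj₂ (proj₂ (stripⁿ-factor E (v i)))

    open UnionCount L w bad? core? core⊆bad

    #bad : ℕ
    #bad = ∑ℕ[ k < L ] χ (anyBad? k)

    X≤T : X ≤ T
    X≤T = begin
      suc (4 * S)             ≤⟨ +-monoˡ-≤ (4 * S) (≤-trans S≥1 (m≤n*m S 4)) ⟩
      4 * S + 4 * S           ≡⟨ double S ⟩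
      8 * S                   ≤⟨ m≤m*n (8 * S) (S * n) {{>-nonZero (*-mono-≤ S≥1 (≤-trans (s≤s z≤n) n≥N₀))}} ⟩
      8 * S * (S * n)         ≡⟨ regroup n S ⟩
      T                       ∎
      where
      open ≤-Reasoning
      double : ∀ s → 4 * s + 4 * s ≡ 8 * s
      double = solve-∀
      regroup : ∀ n s → 8 * s * (s * n) ≡ 2 * (4 * s) * n * s
      regroup = solve-∀

    #bad-bound : T * #bad + #repeated * (X * L) ≤ S * (n * (2 * (X * L) + 2 * (Y * (C * n))))
    #bad-bound = begin
      T * #bad + #repeated * (X * L)                          ≤⟨ +-monoʳ-≤ (T * #bad) repeated-cores ⟩
      T * #bad + T * sum (λ i → χ (repeated? i) * #core i)    ≡⟨ *-distribˡ-+ T #bad _ ⟨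
      T * (#bad + sum (λ i → χ (repeated? i) * #core i))      ≤⟨ *-monoʳ-≤ T count-union ⟩
      T * sum #bad-at                                         ≡⟨ trans (*-assoc Y S _) (*-left-comm Y S (sum #bad-at)) ⟩
      S * (Y * sum #bad-at)                                   ≤⟨ *-monoʳ-≤ S bad-sizes ⟩
      S * (n * (2 * (X * L) + 2 * (Y * (C * n))))             ∎
      where
      open ≤-Reasoning
      #core : Fin n → ℕ
      #core i = ∑ℕ[ k < L ] χ (core? (w i) k)
      #bad-at : Fin n → ℕ
      #bad-at i = ∑ℕ[ k < L ] χ (bad? i k)
      repeated-cores : #repeated * (X * L) ≤ T * sum (λ i → χ (repeated? i) * #core i)
      repeated-cores = begin
        #repeated * (X * L)                           ≡⟨ trans (*-comm #repeated (X * L)) (*-distribˡ-sum (X * L) (χ ∘ repeated?)) ⟩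
        sum (λ i → X * L * χ (repeated? i))           ≡⟨ sum-cong-≗ (λ i → *-comm (X * L) (χ (repeated? i))) ⟩
        sum (λ i → χ (repeated? i) * (X * L))         ≤⟨ sum-mono-≤ (λ i → *-monoʳ-≤ (χ (repeated? i)) (count-cdist-lower L (w∣L i) X T X≤T)) ⟩
        sum (λ i → χ (repeated? i) * (T * #core i))   ≡⟨ sum-cong-≗ (λ i → *-left-comm (χ (repeated? i)) T (#core i)) ⟩
        sum (λ i → T * (χ (repeated? i) * #core i))   ≡⟨ *-distribˡ-sum T (λ i → χ (repeated? i) * #core i) ⟨
        T * sum (λ i → χ (repeated? i) * #core i)     ∎
      bad-sizes : Y * sum #bad-at ≤ n * (2 * (X * L) + 2 * (Y * (C * n)))
      bad-sizes = begin
        Y * sum #bad-at                                  ≡⟨ *-distribˡ-sum Y #bad-at ⟩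
        sum (λ i → Y * #bad-at i)                        ≤⟨ sum-mono-≤ (λ i → count-cdist-upper L (v∣L i) X Y) ⟩
        sum (λ i → 2 * (X * L) + 2 * (Y * v i))          ≤⟨ sum-mono-≤ (λ i → +-monoʳ-≤ (2 * (X * L)) (*-monoʳ-≤ 2 (*-monoʳ-≤ Y (v≤Cn i)))) ⟩
        sum {n} (λ _ → 2 * (X * L) + 2 * (Y * (C * n)))  ≡⟨ sum-const n (2 * (X * L) + 2 * (Y * (C * n))) ⟩
        n * (2 * (X * L) + 2 * (Y * (C * n)))            ∎

    #bad<L : #bad < L
    #bad<L = ≰⇒> λ L≤#bad → <⇒≱ (<-≤-trans (n<1+n Z) (m≤n*m (suc Z) ((C * n) !) {{(C * n) !≢0}})) (L≤Z L≤#bad)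
      where
      open ≤-Reasoning
      L≤Z : L ≤ #bad → L ≤ Z
      L≤Z L≤#bad = *-cancelˡ-≤ n {{>-nonZero (≤-trans (s≤s z≤n) n≥N₀)}} (+-cancelˡ-≤ (4 * S * n * (X * L)) (n * L) (n * Z) (begin
        4 * S * n * (X * L) + n * L                          ≡⟨ expand S n L ⟩
        2 * (T * L) + n * (X * L)                            ≤⟨ +-monoʳ-≤ (2 * (T * L)) (≤-trans (*-monoˡ-≤ (X * L) n≤2*#repeated) (≤-reflexive (*-assoc 2 #repeated (X * L)))) ⟩
        2 * (T * L) + 2 * (#repeated * (X * L))              ≡⟨ *-distribˡ-+ 2 (T * L) _ ⟨
        2 * (T * L + #repeated * (X * L))                    ≤⟨ *-monoʳ-≤ 2 (≤-trans (+-monoˡ-≤ _ (*-monoʳ-≤ T L≤#bad)) #bad-bound) ⟩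
        2 * (S * (n * (2 * (X * L) + 2 * (Y * (C * n)))))    ≡⟨ collect S n X L Y C ⟩
        4 * S * n * (X * L) + n * Z                          ∎))
        where
        expand : ∀ s n l → 4 * s * n * (suc (4 * s) * l) + n * l ≡ 2 * (2 * (4 * s) * n * s * l) + n * (suc (4 * s) * l)
        expand = solve-∀
        collect : ∀ s n x l y c → 2 * (s * (n * (2 * (x * l) + 2 * (y * (c * n))))) ≡ 4 * s * n * (x * l) + n * (4 * s * y * c * n)
        collect = solve-∀

    -- Opaque: unfolding the witness would make the type checker evaluate the whole
    -- counting proof #bad<L.
    opaque
      far-point : ∃ λ k → ∀ i → X * L ≤ Y * cdist L (k * v i)
      far-point = let (k , _ , notBad) = count<⇒∃¬ L anyBad? #bad<L in k , λ i → ≮⇒≥ (λ bad → notBad (i , bad))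

module Rationals where

  open import Data.Nat as ℕ using (ℕ; zero; suc; z≤n; s≤s)
  import Data.Nat.Properties as ℕP
  import Data.Nat.DivMod as ℕD
  import Data.Integer as ℤ
  open ℤ using (ℤ; +_; -[1+_])
  import Data.Integer.Properties as ℤP
  import Data.Integer.DivMod as ℤD
  import Data.Integer.GCD as ℤGCD
  import Data.Rational as ℚ
  open ℚ using (ℚ; ↥_; ↧_; ↧ₙ_; _/_; floor; ceiling; 0ℚ; 1ℚ)
  import Data.Rational.Properties as ℚP
  open import Data.Integer.Tactic.RingSolver using (solve-∀)
  open import Data.Product using (∃; _×_; _,_)
  open import Data.Sum using (inj₁; inj₂)
  open import Function using (_∘_)
  open import Relation.Nullary using (yes; no; contradiction)
  open import Relation.Binary.PropositionalEquality
  open import Defs using (ℤ→ℚ; ‖_‖)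
  open Discrete using (cdist)

  -- p equals a / b, where a / b need not be in lowest terms.
  infix 4 _≃_÷_
  record _≃_÷_ (p : ℚ) (a : ℤ) (b : ℕ) : Set where
    constructor cross
    field
      cross-≡ : ↥ p ℤ.* + b ≡ a ℤ.* ↧ p

  ≃-↥÷↧ : ∀ p → p ≃ ↥ p ÷ ↧ₙ p
  ≃-↥÷↧ p = cross refl

  private
    ↧≢0 : ∀ p → ↧ p ≢ + 0
    ↧≢0 p ()

    ≃÷-from-scaled : ∀ {r a b N D} g → ↥ r ℤ.* g ≡ N → ↧ r ℤ.* g ≡ D → D ≢ + 0 → N ℤ.* + b ≡ a ℤ.* D → r ≃ a ÷ b
    ≃÷-from-scaled {r} {a} {b} {N} {D} g ↥g≡N ↧g≡D D≢0 N*b≡a*D = cross (ℤP.*-cancelʳ-≡ _ _ g {{g≢0}} (begin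
      ↥ r ℤ.* + b ℤ.* g      ≡⟨ swap (↥ r) (+ b) g ⟩
      ↥ r ℤ.* g ℤ.* + b      ≡⟨ cong (ℤ._* + b) ↥g≡N ⟩
      N ℤ.* + b              ≡⟨ N*b≡a*D ⟩
      a ℤ.* D                ≡⟨ cong (a ℤ.*_) ↧g≡D ⟨
      a ℤ.* (↧ r ℤ.* g)      ≡⟨ ℤP.*-assoc a (↧ r) g ⟨
      a ℤ.* ↧ r ℤ.* g        ∎))
      where
      open ≡-Reasoning
      swap : ∀ x y z → x ℤ.* y ℤ.* z ≡ x ℤ.* z ℤ.* y
      swap = solve-∀
      g≢0 : ℤ.NonZero g
      g≢0 = ℤ.≢-nonZero {g} λ { refl → D≢0 (trans (sym ↧g≡D) (ℤP.*-zeroʳ (↧ r))) }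

    ↧*↧≢0 : ∀ p q → ↧ p ℤ.* ↧ q ≢ + 0
    ↧*↧≢0 p q eq with ℤP.i*j≡0⇒i≡0∨j≡0 (↧ p) eq
    ... | inj₁ ↧p≡0 = ↧≢0 p ↧p≡0
    ... | inj₂ ↧q≡0 = ↧≢0 q ↧q≡0

  /-≃÷ : ∀ i n .{{_ : ℕ.NonZero n}} → i / n ≃ i ÷ n
  /-≃÷ i n = ≃÷-from-scaled (ℤGCD.gcd i (+ n)) (ℚP.↥-/ i n) (ℚP.↧-/ i n) (ℕ.≢-nonZero⁻¹ n ∘ ℤP.+-injective) refl

  ≃÷-* : ∀ {p q a b c d} → p ≃ a ÷ b → q ≃ c ÷ d → p ℚ.* q ≃ a ℤ.* c ÷ b ℕ.* d
  ≃÷-* {p} {q} {a} {b} {c} {d} (cross hp) (cross hq) =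
    ≃÷-from-scaled _ (ℚP.↥-* p q) (ℚP.↧-* p q) (↧*↧≢0 p q) (begin
      ↥ p ℤ.* ↥ q ℤ.* + (b ℕ.* d)              ≡⟨ cong (↥ p ℤ.* ↥ q ℤ.*_) (ℤP.pos-* b d) ⟩
      ↥ p ℤ.* ↥ q ℤ.* (+ b ℤ.* + d)            ≡⟨ pair (↥ p) (↥ q) (+ b) (+ d) ⟩
      (↥ p ℤ.* + b) ℤ.* (↥ q ℤ.* + d)          ≡⟨ cong₂ ℤ._*_ hp hq ⟩
      (a ℤ.* ↧ p) ℤ.* (c ℤ.* ↧ q)              ≡⟨ pair a c (↧ p) (↧ q) ⟨
      a ℤ.* c ℤ.* (↧ p ℤ.* ↧ q)                ∎)
    where
    open ≡-Reasoning
    pair : ∀ x y z w → x ℤ.* y ℤ.* (z ℤ.* w) ≡ (x ℤ.* z) ℤ.* (y ℤ.* w)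
    pair = solve-∀

  ≃÷-+ : ∀ {p q a b c d} → p ≃ a ÷ b → q ≃ c ÷ d → p ℚ.+ q ≃ a ℤ.* + d ℤ.+ c ℤ.* + b ÷ b ℕ.* d
  ≃÷-+ {p} {q} {a} {b} {c} {d} (cross hp) (cross hq) =
    ≃÷-from-scaled _ (ℚP.↥-+ p q) (ℚP.↧-+ p q) (↧*↧≢0 p q) (begin
      (↥ p ℤ.* ↧ q ℤ.+ ↥ q ℤ.* ↧ p) ℤ.* + (b ℕ.* d)                   ≡⟨ cong ((↥ p ℤ.* ↧ q ℤ.+ ↥ q ℤ.* ↧ p) ℤ.*_) (ℤP.pos-* b d) ⟩
      (↥ p ℤ.* ↧ q ℤ.+ ↥ q ℤ.* ↧ p) ℤ.* (+ b ℤ.* + d)                 ≡⟨ spread (↥ p) (↧ q) (↥ q) (↧ p) (+ b) (+ d) ⟩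
      (↥ p ℤ.* + b) ℤ.* (↧ q ℤ.* + d) ℤ.+ (↥ q ℤ.* + d) ℤ.* (↧ p ℤ.* + b) ≡⟨ cong₂ (λ x y → x ℤ.* (↧ q ℤ.* + d) ℤ.+ y ℤ.* (↧ p ℤ.* + b)) hp hq ⟩
      (a ℤ.* ↧ p) ℤ.* (↧ q ℤ.* + d) ℤ.+ (c ℤ.* ↧ q) ℤ.* (↧ p ℤ.* + b) ≡⟨ gather a (↧ p) (↧ q) (+ d) c (+ b) ⟩
      (a ℤ.* + d ℤ.+ c ℤ.* + b) ℤ.* (↧ p ℤ.* ↧ q)                     ∎)
    where
    open ≡-Reasoning
    spread : ∀ x y u v z w → (x ℤ.* y ℤ.+ u ℤ.* v) ℤ.* (z ℤ.* w) ≡ (x ℤ.* z) ℤ.* (y ℤ.* w) ℤ.+ (u ℤ.* w) ℤ.* (v ℤ.* z)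
    spread = solve-∀
    gather : ∀ a x y e c f → (a ℤ.* x) ℤ.* (y ℤ.* e) ℤ.+ (c ℤ.* y) ℤ.* (x ℤ.* f) ≡ (a ℤ.* e ℤ.+ c ℤ.* f) ℤ.* (x ℤ.* y)
    gather = solve-∀

  ≃÷-neg : ∀ {p a b} → p ≃ a ÷ b → ℚ.- p ≃ ℤ.- a ÷ b
  ≃÷-neg {p} {a} {b} (cross hp) = cross (begin
    ↥ (ℚ.- p) ℤ.* + b     ≡⟨ cong (ℤ._* + b) (ℚP.↥-neg p) ⟩
    ℤ.- ↥ p ℤ.* + b       ≡⟨ ℤP.neg-distribˡ-* (↥ p) (+ b) ⟨
    ℤ.- (↥ p ℤ.* + b)     ≡⟨ cong ℤ.-_ hp ⟩
    ℤ.- (a ℤ.* ↧ p)       ≡⟨ ℤP.neg-distribˡ-* a (↧ p) ⟩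
    ℤ.- a ℤ.* ↧ p         ≡⟨ cong (ℤ.- a ℤ.*_) (ℚP.↧-neg p) ⟨
    ℤ.- a ℤ.* ↧ (ℚ.- p)   ∎)
    where open ≡-Reasoning

  ÷-≤⇒≤ : ∀ {p q a b c d} → p ≃ a ÷ b → q ≃ c ÷ d → .{{ℕ.NonZero b}} → .{{ℕ.NonZero d}} → a ℤ.* + d ℤ.≤ c ℤ.* + b → p ℚ.≤ q
  ÷-≤⇒≤ {p} {q} {a} {b} {c} {d} (cross hp) (cross hq) ad≤cb = ℚ.*≤* (ℤP.*-cancelʳ-≤-pos _ _ (+ b ℤ.* + d) {{b*d>0}} (begin
    ↥ p ℤ.* ↧ q ℤ.* (+ b ℤ.* + d)      ≡⟨ pair (↥ p) (↧ q) (+ b) (+ d) ⟩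
    (↥ p ℤ.* + b) ℤ.* (↧ q ℤ.* + d)    ≡⟨ cong (ℤ._* (↧ q ℤ.* + d)) hp ⟩
    (a ℤ.* ↧ p) ℤ.* (↧ q ℤ.* + d)      ≡⟨ pull a (↧ p) (↧ q) (+ d) ⟩
    (a ℤ.* + d) ℤ.* (↧ p ℤ.* ↧ q)      ≤⟨ ℤP.*-monoʳ-≤-nonNeg (↧ p ℤ.* ↧ q) {{↧*↧≥0}} ad≤cb ⟩
    (c ℤ.* + b) ℤ.* (↧ p ℤ.* ↧ q)      ≡⟨ pull′ c (+ b) (↧ p) (↧ q) ⟩
    (c ℤ.* ↧ q) ℤ.* (↧ p ℤ.* + b)      ≡⟨ cong (ℤ._* (↧ p ℤ.* + b)) hq ⟨
    (↥ q ℤ.* + d) ℤ.* (↧ p ℤ.* + b)    ≡⟨ push (↥ q) (+ d) (↧ p) (+ b) ⟩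
    ↥ q ℤ.* ↧ p ℤ.* (+ b ℤ.* + d)      ∎))
    where
    open ℤP.≤-Reasoning
    pair : ∀ x y z w → x ℤ.* y ℤ.* (z ℤ.* w) ≡ (x ℤ.* z) ℤ.* (y ℤ.* w)
    pair = solve-∀
    pull : ∀ a x y z → (a ℤ.* x) ℤ.* (y ℤ.* z) ≡ (a ℤ.* z) ℤ.* (x ℤ.* y)
    pull = solve-∀
    pull′ : ∀ c z x y → (c ℤ.* z) ℤ.* (x ℤ.* y) ≡ (c ℤ.* y) ℤ.* (x ℤ.* z)
    pull′ = solve-∀
    push : ∀ x z y w → (x ℤ.* z) ℤ.* (y ℤ.* w) ≡ x ℤ.* y ℤ.* (w ℤ.* z)
    push = solve-∀
    ↧*↧≥0 : ℤ.NonNegative (↧ p ℤ.* ↧ q)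
    ↧*↧≥0 = subst ℤ.NonNegative (sym (ℤP.pos-* (↧ₙ p) (↧ₙ q))) _
    b*d>0 : ℤ.Positive (+ b ℤ.* + d)
    b*d>0 = subst ℤ.Positive (ℤP.pos-* b d) (ℤ.positive (ℤ.+<+ (ℕ.>-nonZero⁻¹ (b ℕ.* d) {{ℕP.m*n≢0 b d}})))

  ≤⇒÷-≤ : ∀ {p q a b c d} → p ≃ a ÷ b → q ≃ c ÷ d → p ℚ.≤ q → a ℤ.* + d ℤ.≤ c ℤ.* + b
  ≤⇒÷-≤ {p} {q} {a} {b} {c} {d} (cross hp) (cross hq) (ℚ.*≤* p≤q) = ℤP.*-cancelʳ-≤-pos _ _ (↧ p ℤ.* ↧ q) {{↧*↧>0}} (begin
    (a ℤ.* + d) ℤ.* (↧ p ℤ.* ↧ q)      ≡⟨ pull a (+ d) (↧ p) (↧ q) ⟩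
    (a ℤ.* ↧ p) ℤ.* (↧ q ℤ.* + d)      ≡⟨ cong (ℤ._* (↧ q ℤ.* + d)) hp ⟨
    (↥ p ℤ.* + b) ℤ.* (↧ q ℤ.* + d)    ≡⟨ pair (↥ p) (+ b) (↧ q) (+ d) ⟩
    ↥ p ℤ.* ↧ q ℤ.* (+ b ℤ.* + d)      ≤⟨ ℤP.*-monoʳ-≤-nonNeg (+ b ℤ.* + d) {{b*d≥0}} p≤q ⟩
    ↥ q ℤ.* ↧ p ℤ.* (+ b ℤ.* + d)      ≡⟨ push (↥ q) (↧ p) (+ b) (+ d) ⟩
    (↥ q ℤ.* + d) ℤ.* (↧ p ℤ.* + b)    ≡⟨ cong (ℤ._* (↧ p ℤ.* + b)) hq ⟩
    (c ℤ.* ↧ q) ℤ.* (↧ p ℤ.* + b)      ≡⟨ pull′ c (+ b) (↧ p) (↧ q) ⟨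
    (c ℤ.* + b) ℤ.* (↧ p ℤ.* ↧ q)      ∎)
    where
    open ℤP.≤-Reasoning
    pull : ∀ a e x y → (a ℤ.* e) ℤ.* (x ℤ.* y) ≡ (a ℤ.* x) ℤ.* (y ℤ.* e)
    pull = solve-∀
    pull′ : ∀ c z x y → (c ℤ.* z) ℤ.* (x ℤ.* y) ≡ (c ℤ.* y) ℤ.* (x ℤ.* z)
    pull′ = solve-∀
    pair : ∀ x z y w → (x ℤ.* z) ℤ.* (y ℤ.* w) ≡ x ℤ.* y ℤ.* (z ℤ.* w)
    pair = solve-∀
    push : ∀ x y z w → x ℤ.* y ℤ.* (z ℤ.* w) ≡ (x ℤ.* w) ℤ.* (y ℤ.* z)
    push = solve-∀
    b*d≥0 : ℤ.NonNegative (+ b ℤ.* + d)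
    b*d≥0 = subst ℤ.NonNegative (ℤP.pos-* b d) _
    ↧*↧>0 : ℤ.Positive (↧ p ℤ.* ↧ q)
    ↧*↧>0 = subst ℤ.Positive (sym (ℤP.pos-* (↧ₙ p) (↧ₙ q))) (ℤ.positive (ℤ.+<+ (ℕ.>-nonZero⁻¹ (↧ₙ p ℕ.* ↧ₙ q) {{ℕP.m*n≢0 (↧ₙ p) (↧ₙ q)}})))

  floor*↧≤↥ : ∀ p → floor p ℤ.* ↧ p ℤ.≤ ↥ p
  floor*↧≤↥ (ℚ.mkℚ n d-1 _) = ℤD.[n/d]*d≤n n (+ suc d-1)

  floor≤ : ∀ p → ℤ→ℚ (floor p) ℚ.≤ p
  floor≤ p = ÷-≤⇒≤ (/-≃÷ (floor p) 1) (≃-↥÷↧ p) (ℤP.≤-trans (floor*↧≤↥ p) (ℤP.≤-reflexive (sym (ℤP.*-identityʳ (↥ p)))))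

  ≤ceiling : ∀ p → p ℚ.≤ ℤ→ℚ (ceiling p)
  ≤ceiling p@(ℚ.mkℚ _ _ _) = ÷-≤⇒≤ (≃-↥÷↧ p) (/-≃÷ (ceiling p) 1) (begin
    ↥ p ℤ.* + 1                        ≡⟨ ℤP.*-identityʳ (↥ p) ⟩
    ↥ p                                ≡⟨ ℤP.neg-involutive (↥ p) ⟨
    ℤ.- (ℤ.- ↥ p)                      ≤⟨ ℤP.neg-mono-≤ floor[-p]*↧p≤-↥p ⟩
    ℤ.- (floor (ℚ.- p) ℤ.* ↧ p)        ≡⟨ ℤP.neg-distribˡ-* (floor (ℚ.- p)) (↧ p) ⟩
    ceiling p ℤ.* ↧ p                  ∎)
    where
    open ℤP.≤-Reasoning
    floor[-p]*↧p≤-↥p : floor (ℚ.- p) ℤ.* ↧ p ℤ.≤ ℤ.- ↥ p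
    floor[-p]*↧p≤-↥p = subst₂ (λ d n → floor (ℚ.- p) ℤ.* d ℤ.≤ n) (ℚP.↧-neg p) (ℚP.↥-neg p) (floor*↧≤↥ (ℚ.- p))

  module _ (L : ℕ) {{_ : ℕ.NonZero L}} (a : ℕ) where

    private
      r q : ℕ
      r = a ℕD.% L
      q = a ℕD./ L

      a≡r+qL : + a ≡ + r ℤ.+ + q ℤ.* + L
      a≡r+qL = trans (cong +_ (ℕD.m≡m%n+[m/n]*n a L)) (trans (ℤP.pos-+ r (q ℕ.* L)) (cong (ℤ._+_ (+ r)) (ℤP.pos-* q L)))

    %≤-floor-gap : ∀ f → f ℤ.* + L ℤ.≤ + a → + r ℤ.≤ + a ℤ.- f ℤ.* + L
    %≤-floor-gap f fL≤a = begin
      + r                        ≡⟨ cancel (+ r) (+ q ℤ.* + L) ⟨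
      + r ℤ.+ + q ℤ.* + L ℤ.- + q ℤ.* + L   ≡⟨ cong (ℤ._- + q ℤ.* + L) a≡r+qL ⟨
      + a ℤ.- + q ℤ.* + L        ≤⟨ ℤP.+-monoʳ-≤ (+ a) (ℤP.neg-mono-≤ (ℤP.*-monoʳ-≤-nonNeg (+ L) f≤q)) ⟩
      + a ℤ.- f ℤ.* + L          ∎
      where
      open ℤP.≤-Reasoning
      cancel : ∀ x y → x ℤ.+ y ℤ.- y ≡ x
      cancel = solve-∀
      f≤q : f ℤ.≤ + q
      f≤q with f ℤ.≤? + q
      ... | yes f≤q = f≤q
      ... | no  f≰q = contradiction (ℤP.≤-trans (ℤP.*-monoʳ-≤-nonNeg (+ L) (ℤP.i<j⇒suc[i]≤j (ℤP.≰⇒> f≰q))) fL≤a) (ℤP.<⇒≱ a<[q+1]L)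
        where
        a<[q+1]L : + a ℤ.< ℤ.suc (+ q) ℤ.* + L
        a<[q+1]L = subst (+ a ℤ.<_) (ℤP.pos-* (suc q) L) (ℤ.+<+ (ℕP.≤-trans (s≤s (ℕP.≤-reflexive (ℕD.m≡m%n+[m/n]*n a L))) (ℕP.+-monoˡ-≤ (q ℕ.* L) (ℕD.m%n<n a L))))

    ∸%≤-ceiling-gap : ∀ c → 1 ℕ.≤ r → + a ℤ.≤ c ℤ.* + L → + (L ℕ.∸ r) ℤ.≤ c ℤ.* + L ℤ.- + a
    ∸%≤-ceiling-gap c r≥1 a≤cL = begin
      + (L ℕ.∸ r)                          ≡⟨ cancel (+ (L ℕ.∸ r)) (+ a) ⟨
      + (L ℕ.∸ r) ℤ.+ + a ℤ.- + a          ≡⟨ cong (ℤ._- + a) (trans (sym (ℤP.pos-+ (L ℕ.∸ r) a)) (trans (cong +_ L∸r+a≡[q+1]L) (ℤP.pos-* (suc q) L))) ⟩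
      + suc q ℤ.* + L ℤ.- + a              ≤⟨ ℤP.+-monoˡ-≤ (ℤ.- + a) (ℤP.*-monoʳ-≤-nonNeg (+ L) q+1≤c) ⟩
      c ℤ.* + L ℤ.- + a                    ∎
      where
      open ℤP.≤-Reasoning
      cancel : ∀ x y → x ℤ.+ y ℤ.- y ≡ x
      cancel = solve-∀
      L∸r+a≡[q+1]L : L ℕ.∸ r ℕ.+ a ≡ suc q ℕ.* L
      L∸r+a≡[q+1]L = trans (cong (L ℕ.∸ r ℕ.+_) (ℕD.m≡m%n+[m/n]*n a L))
                    (trans (sym (ℕP.+-assoc (L ℕ.∸ r) r (q ℕ.* L)))
                           (cong (ℕ._+ q ℕ.* L) (ℕP.m∸n+n≡m (ℕP.<⇒≤ (ℕD.m%n<n a L)))))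
      q+1≤c : + suc q ℤ.≤ c
      q+1≤c with + suc q ℤ.≤? c
      ... | yes q+1≤c = q+1≤c
      ... | no  q+1≰c = contradiction (ℤP.≤-trans a≤cL (ℤP.*-monoʳ-≤-nonNeg (+ L) (ℤP.i<j⇒i≤pred[j] (ℤP.≰⇒> q+1≰c)))) (ℤP.<⇒≱ qL<a)
        where
        qL<a : ℤ.pred (+ suc q) ℤ.* + L ℤ.< + a
        qL<a = subst (ℤ._< + a) (ℤP.pos-* q L) (ℤ.+<+ (ℕP.≤-trans (ℕP.+-monoˡ-≤ (q ℕ.* L) r≥1) (ℕP.≤-reflexive (sym (ℕD.m≡m%n+[m/n]*n a L)))))

  cdist≤‖‖ : ∀ {x L a} X Y {{_ : ℕ.NonZero L}} {{_ : ℕ.NonZero Y}} → x ≃ + a ÷ L → 1 ℕ.≤ X →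
             X ℕ.* L ℕ.≤ Y ℕ.* cdist L a → (+ X) / Y ℚ.≤ ‖ x ‖
  cdist≤‖‖ {x} {L} {a} X Y x≃a÷L X≥1 XL≤Y*cdist = ℚP.⊓-glb (÷-≤⇒≤ (/-≃÷ (+ X) Y) x-floor≃ below)
                                                          (÷-≤⇒≤ (/-≃÷ (+ X) Y) ceiling-x≃ above)
    where
    open ℤP.≤-Reasoning
    instance
      L*1≢0 : ℕ.NonZero (L ℕ.* 1)
      L*1≢0 = ℕP.m*n≢0 L 1
      1*L≢0 : ℕ.NonZero (1 ℕ.* L)
      1*L≢0 = ℕP.m*n≢0 1 L
    fl ce : ℤ
    fl = floor x
    ce = ceiling x
    r : ℕ
    r = a ℕD.% L
    x-floor≃ : x ℚ.- ℤ→ℚ fl ≃ + a ℤ.* + 1 ℤ.+ ℤ.- fl ℤ.* + L ÷ L ℕ.* 1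
    x-floor≃ = ≃÷-+ x≃a÷L (≃÷-neg (/-≃÷ fl 1))
    ceiling-x≃ : ℤ→ℚ ce ℚ.- x ≃ ce ℤ.* + L ℤ.+ ℤ.- (+ a) ℤ.* + 1 ÷ 1 ℕ.* L
    ceiling-x≃ = ≃÷-+ (/-≃÷ ce 1) (≃÷-neg x≃a÷L)
    fl*L≤a : fl ℤ.* + L ℤ.≤ + a
    fl*L≤a = ℤP.≤-trans (≤⇒÷-≤ (/-≃÷ fl 1) x≃a÷L (floor≤ x)) (ℤP.≤-reflexive (ℤP.*-identityʳ (+ a)))
    a≤ce*L : + a ℤ.≤ ce ℤ.* + L
    a≤ce*L = ℤP.≤-trans (ℤP.≤-reflexive (sym (ℤP.*-identityʳ (+ a)))) (≤⇒÷-≤ x≃a÷L (/-≃÷ ce 1) (≤ceiling x))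
    XL≤[m]Y : ∀ {m} → cdist L a ℕ.≤ m → + X ℤ.* + L ℤ.≤ + m ℤ.* + Y
    XL≤[m]Y {m} cdist≤m = begin
      + X ℤ.* + L            ≡⟨ ℤP.pos-* X L ⟨
      + (X ℕ.* L)            ≤⟨ ℤ.+≤+ (ℕP.≤-trans XL≤Y*cdist (ℕP.≤-trans (ℕP.*-monoʳ-≤ Y cdist≤m) (ℕP.≤-reflexive (ℕP.*-comm Y m)))) ⟩
      + (m ℕ.* Y)            ≡⟨ ℤP.pos-* m Y ⟩
      + m ℤ.* + Y            ∎
    r≥1 : 1 ℕ.≤ r
    r≥1 = ℕP.≤-trans (ℕP.n≢0⇒n>0 cdist≢0) (ℕP.m⊓n≤m r (L ℕ.∸ r))
      where
      cdist≢0 : cdist L a ≢ 0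
      cdist≢0 cdist≡0 = ℕP.<-irrefl refl (ℕP.<-≤-trans (ℕP.*-mono-≤ X≥1 (ℕ.>-nonZero⁻¹ L))
        (ℕP.≤-trans (subst (λ c → X ℕ.* L ℕ.≤ Y ℕ.* c) cdist≡0 XL≤Y*cdist) (ℕP.≤-reflexive (ℕP.*-zeroʳ Y))))
    below : + X ℤ.* + (L ℕ.* 1) ℤ.≤ (+ a ℤ.* + 1 ℤ.+ ℤ.- fl ℤ.* + L) ℤ.* + Y
    below = begin
      + X ℤ.* + (L ℕ.* 1)                        ≡⟨ cong (λ l → + X ℤ.* + l) (ℕP.*-identityʳ L) ⟩
      + X ℤ.* + L                                ≤⟨ XL≤[m]Y (ℕP.m⊓n≤m r (L ℕ.∸ r)) ⟩
      + r ℤ.* + Y                                ≤⟨ ℤP.*-monoʳ-≤-nonNeg (+ Y) (%≤-floor-gap L a fl fl*L≤a) ⟩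
      (+ a ℤ.- fl ℤ.* + L) ℤ.* + Y               ≡⟨ cong (ℤ._* + Y) (rearrange (+ a) fl (+ L)) ⟩
      (+ a ℤ.* + 1 ℤ.+ ℤ.- fl ℤ.* + L) ℤ.* + Y   ∎
      where
      rearrange : ∀ a f l → a ℤ.- f ℤ.* l ≡ a ℤ.* + 1 ℤ.+ ℤ.- f ℤ.* l
      rearrange = solve-∀
    above : + X ℤ.* + (1 ℕ.* L) ℤ.≤ (ce ℤ.* + L ℤ.+ ℤ.- (+ a) ℤ.* + 1) ℤ.* + Y
    above = begin
      + X ℤ.* + (1 ℕ.* L)                        ≡⟨ cong (λ l → + X ℤ.* + l) (ℕP.*-identityˡ L) ⟩
      + X ℤ.* + L                                ≤⟨ XL≤[m]Y (ℕP.m⊓n≤n r (L ℕ.∸ r)) ⟩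
      + (L ℕ.∸ r) ℤ.* + Y                        ≤⟨ ℤP.*-monoʳ-≤-nonNeg (+ Y) (∸%≤-ceiling-gap L a ce r≥1 a≤ce*L) ⟩
      (ce ℤ.* + L ℤ.- + a) ℤ.* + Y               ≡⟨ cong (ℤ._* + Y) (rearrange ce (+ L) (+ a)) ⟩
      (ce ℤ.* + L ℤ.+ ℤ.- (+ a) ℤ.* + 1) ℤ.* + Y ∎
      where
      rearrange : ∀ c l a → c ℤ.* l ℤ.- a ≡ c ℤ.* l ℤ.+ ℤ.- a ℤ.* + 1
      rearrange = solve-∀

  [k/L]*v≃kv÷L : ∀ k v L .{{_ : ℕ.NonZero L}} → (+ k) / L ℚ.* ℤ→ℚ (+ v) ≃ + (k ℕ.* v) ÷ L
  [k/L]*v≃kv÷L k v L = subst₂ (λ a b → (+ k) / L ℚ.* ℤ→ℚ (+ v) ≃ a ÷ b) (sym (ℤP.pos-* k v)) (ℕP.*-identityʳ L)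
                               (≃÷-* (/-≃÷ (+ k) L) (/-≃÷ (+ v) 1))

  numerator-bound : ∀ C → 0ℚ ℚ.< C → ∃ λ C′ → 1 ℕ.≤ C′ × (∀ x n → (+ x) ℚ./ 1 ℚ.≤ C ℚ.* ((+ n) ℚ./ 1) → x ℕ.≤ C′ ℕ.* n)
  numerator-bound C@(ℚ.mkℚ (+ suc m) _ _) _ = suc m , s≤s z≤n , λ x n x≤Cn →
    let x*↧C≤[1+m]*n = ≤⇒÷-≤ (/-≃÷ (+ x) 1) (≃÷-* (≃-↥÷↧ C) (/-≃÷ (+ n) 1)) x≤Cn in
    ℕP.≤-trans (ℕP.m≤m*n x (↧ₙ C)) (ℤP.drop‿+≤+ (subst₂ ℤ._≤_ (x*↧C≡ x) ([1+m]*n≡ n) x*↧C≤[1+m]*n))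
    where
    x*↧C≡ : ∀ x → + x ℤ.* + (↧ₙ C ℕ.* 1) ≡ + (x ℕ.* ↧ₙ C)
    x*↧C≡ x = trans (cong (λ d → + x ℤ.* + d) (ℕP.*-identityʳ (↧ₙ C))) (sym (ℤP.pos-* x (↧ₙ C)))
    [1+m]*n≡ : ∀ n → + suc m ℤ.* + n ℤ.* + 1 ≡ + (suc m ℕ.* n)
    [1+m]*n≡ n = trans (ℤP.*-identityʳ _) (sym (ℤP.pos-* (suc m) n))
  numerator-bound (ℚ.mkℚ (+ zero) _ _) (ℚ.*<* (ℤ.+<+ ()))
  numerator-bound (ℚ.mkℚ -[1+ _ ] _ _) (ℚ.*<* ())

  [1+1/d]/2n≤ : ∀ d n .{{_ : ℕ.NonZero d}} .{{_ : ℕ.NonZero n}} .{{_ : ℕ.NonZero (2 ℕ.* d ℕ.* n)}} →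
                (1ℚ ℚ.+ (+ 1) ℚ./ d) ℚ.* ((+ 1) ℚ./ 2) ℚ.* ((+ 1) ℚ./ n) ℚ.≤ (+ suc d) ℚ./ (2 ℕ.* d ℕ.* n)
  [1+1/d]/2n≤ d n =
    ÷-≤⇒≤ (≃÷-* (≃÷-* (≃÷-+ (/-≃÷ (+ 1) 1) (/-≃÷ (+ 1) d)) (/-≃÷ (+ 1) 2)) (/-≃÷ (+ 1) n)) (/-≃÷ (+ suc d) (2 ℕ.* d ℕ.* n))
          {{ℕP.m*n≢0 _ n {{ℕP.m*n≢0 _ 2 {{ℕP.m*n≢0 1 d}}}}}}
          (ℤP.≤-reflexive (begin
      (+ 1 ℤ.* + d ℤ.+ + 1 ℤ.* + 1) ℤ.* + 1 ℤ.* + 1 ℤ.* + (2 ℕ.* d ℕ.* n)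
        ≡⟨ cong (ℤ._*_ ((+ 1 ℤ.* + d ℤ.+ + 1 ℤ.* + 1) ℤ.* + 1 ℤ.* + 1)) (lift₃ 2 d n) ⟩
      (+ 1 ℤ.* + d ℤ.+ + 1 ℤ.* + 1) ℤ.* + 1 ℤ.* + 1 ℤ.* (+ 2 ℤ.* + d ℤ.* + n)
        ≡⟨ identity (+ d) (+ n) ⟩
      + suc d ℤ.* (+ 1 ℤ.* + d ℤ.* + 2 ℤ.* + n)
        ≡⟨ cong (λ m → + suc d ℤ.* (m ℤ.* + 2 ℤ.* + n)) (ℤP.pos-* 1 d) ⟨
      + suc d ℤ.* (+ (1 ℕ.* d) ℤ.* + 2 ℤ.* + n)
        ≡⟨ cong (ℤ._*_ (+ suc d)) (lift₃ (1 ℕ.* d) 2 n) ⟨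
      + suc d ℤ.* + (1 ℕ.* d ℕ.* 2 ℕ.* n)
        ∎))
    where
    open ≡-Reasoning
    lift₃ : ∀ a b c → + (a ℕ.* b ℕ.* c) ≡ + a ℤ.* + b ℤ.* + c
    lift₃ a b c = trans (ℤP.pos-* (a ℕ.* b) c) (cong (ℤ._* + c) (ℤP.pos-* a b))
    identity : ∀ d n → (+ 1 ℤ.* d ℤ.+ + 1 ℤ.* + 1) ℤ.* + 1 ℤ.* + 1 ℤ.* (+ 2 ℤ.* d ℤ.* n) ≡ (+ 1 ℤ.+ d) ℤ.* (+ 1 ℤ.* d ℤ.* + 2 ℤ.* n)
    identity = solve-∀

open import Defs
open import Data.Nat using (ℕ; _≥_; NonZero)
open import Data.Integer using (ℤ; +_)
open import Data.Fin using (Fin)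
open import Data.Product using (∃; _×_)
open import Data.Rational using (ℚ; _+_; _*_; _/_; _≤_; _<_; 0ℚ; 1ℚ)
import Data.Rational.Properties as ℚP
open import Data.Nat using (s≤s; z≤n)
open import Data.Product using (_,_)
open Discrete using (module Parameters; module DiscreteBound)
open Rationals

proposition1p7 : (C : ℚ) → 0ℚ < C →
    ∃ λ (c : ℚ) → 0ℚ < c × ∃ λ (N : ℕ) →
    ∀ (n : ℕ) → .{{_ : NonZero n}} → n ≥ N →
    ∀ (v : Fin n → ℕ) →
    (∀ i → 1 Data.Nat.≤ v i) →
    (∀ i → (+ v i) / 1 ≤ C * ((+ n) / 1)) →
    δ-≥ (λ i → + v i) ((1ℚ + c) * ((+ 1) / 2) * ((+ 1) / n))
proposition1p7 C 0<C =
  let (C′ , C′≥1 , v≤C′n) = numerator-bound C 0<C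
      open Parameters C′
  in  (+ 1) / d , ℚP.positive⁻¹ _ {{ℚP.normalize-pos 1 d}} , N₀ ,
      λ n n≥N₀ v v≥1 v≤Cn →
        let open DiscreteBound C′ n v C′≥1 n≥N₀ v≥1 (λ i → v≤C′n (v i) n (v≤Cn i))
            (k , far) = far-point
        in  (+ k) / L , λ i →
              ℚP.≤-trans ([1+1/d]/2n≤ d n) (cdist≤‖‖ X Y ([k/L]*v≃kv÷L k (v i) L) (s≤s z≤n) (far i))
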